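{- Let $n\ge2$ and $G=\mathcal{C}_n^+$. Then $1\in V_G(2)$, and if $n\ge8$ then $V_G(2)=\mathbb{Z}_{\ge0}$.
   Context: $\mathcal{C}_n$ is the cycle on $n$ vertices ($\mathcal{C}_2$ being two vertices joined by two edges), and $\mathcal{C}_n^+$ is the graph on $n+1$ vertices obtained from $\mathcal{C}_n$ by attaching one new vertex by a single edge to one vertex of the cycle. For a graph $G$ with vertices $v_1,\dots,v_n$, $A_G$ is the adjacency matrix ($(i,j)$ entry = number of edges between $v_i,v_j$), $M_G(a_1,\dots,a_n)=\mathrm{Diag}(a_1,\dots,a_n)-A_G$. For $M\in M_n(\mathbb{Z})$, $\Phi_M$ is the torsion subgroup of $\mathbb{Z}^n/\mathrm{Im}(M)$. A symmetric integer matrix is positive definite (resp. semi-definite) if ${}^tXBX>0$ (resp. $\ge0$) for all nonzero integer $X$. $V_G(r)$ is the set of $u\in\mathbb{Z}_{\ge0}$ for which there exist integers $a_1,\dots,a_n\ge r$ with $u=\det M_G(a_1,\dots,a_n)$, $M_G(a_1,\dots,a_n)$ positive definite if $u\ne0$ and positive semi-definite of rank $n-1$ if $u=0$, and $\Phi_{M_G(a_1,\dots,a_n)}$ cyclic. -}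

module Defs where

open import Data.Nat as ℕ using (ℕ; zero; suc; _≡ᵇ_)
open import Data.Bool using (Bool; true; false; if_then_else_)
open import Data.Fin using (Fin; toℕ; punchIn)
  renaming (zero to fzero; suc to fsuc)
open import Data.Integer as ℤ using (ℤ; +_; _+_; _*_; -_; _-_; _<_; _≤_)
open import Data.Product using (Σ; ∃; _×_)
open import Relation.Binary.PropositionalEquality using (_≡_; _≢_)

Mat : ℕ → Set
Mat m = Fin m → Fin m → ℤ

Vecℤ : ℕ → Set
Vecℤ m = Fin m → ℤ

Σ[_] : ∀ {m} → (Fin m → ℤ) → ℤ
Σ[_] {zero} f = + 0
Σ[_] {suc m} f = f fzero + Σ[ (λ i → f (fsuc i)) ]

minor : ∀ {m} → Fin (suc m) → Fin (suc m) → Mat (suc m) → Mat m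
minor i j M k l = M (punchIn i k) (punchIn j l)

sign : ℕ → ℤ
sign zero = + 1
sign (suc zero) = - (+ 1)
sign (suc (suc k)) = sign k

det : ∀ {m} → Mat m → ℤ
det {zero} M = + 1
det {suc m} M = Σ[ (λ j → sign (toℕ j) * (M fzero j * det (minor fzero j M))) ]

_·_ : ∀ {m} → Mat m → Vecℤ m → Vecℤ m
(M · x) i = Σ[ (λ j → M i j * x j) ]

quad : ∀ {m} → Mat m → Vecℤ m → ℤ
quad B X = Σ[ (λ i → Σ[ (λ j → X i * (B i j * X j)) ]) ]

NonZeroVec : ∀ {m} → Vecℤ m → Set
NonZeroVec X = ∃ λ i → X i ≢ + 0

PosDef : ∀ {m} → Mat m → Set
PosDef B = ∀ X → NonZeroVec X → + 0 < quad B X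

PosSemiDef : ∀ {m} → Mat m → Set
PosSemiDef B = ∀ X → + 0 ≤ quad B X

-- Rank (determinantal rank) of an (m+1)×(m+1) matrix equals m:
-- all (m+1)-minors (i.e. det) vanish and some m×m minor is nonzero.
RankPred : ∀ {m} → Mat (suc m) → Set
RankPred M = det M ≡ + 0 × ∃ λ i → ∃ λ j → det (minor i j M) ≢ + 0

InIm : ∀ {m} → Mat m → Vecℤ m → Set
InIm M y = ∃ λ x → ∀ i → (M · x) i ≡ y i

IsTorsion : ∀ {m} → Mat m → Vecℤ m → Set
IsTorsion M y = ∃ λ (k : ℤ) → k ≢ + 0 × InIm M (λ i → k * y i)

-- Φ_M (torsion subgroup of ℤ^m / Im M) is cyclic: generated by the class of one
-- torsion element g.
PhiCyclic : ∀ {m} → Mat m → Set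
PhiCyclic M = ∃ λ g → IsTorsion M g ×
  (∀ y → IsTorsion M y → ∃ λ (c : ℤ) → InIm M (λ i → y i - c * g i))

-- Graph C_n^+ : vertices 0..n (Fin (suc n)); cycle 0,1,...,n-1,0 on the first
-- n vertices (for n = 2 this gives two parallel edges between 0 and 1), and
-- the pendant vertex n attached to vertex 0.
δ : ℕ → ℕ → ℕ
δ a b = if a ≡ᵇ b then 1 else 0

nextC : ℕ → ℕ → ℕ
nextC n k = if suc k ≡ᵇ n then 0 else suc k

sumℕ : ℕ → (ℕ → ℕ) → ℕ
sumℕ zero f = 0
sumℕ (suc n) f = sumℕ n f ℕ.+ f n

adjCount : ℕ → ℕ → ℕ → ℕ
adjCount n i j =
  sumℕ n (λ k → δ i k ℕ.* δ j (nextC n k) ℕ.+ δ j k ℕ.* δ i (nextC n k))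
  ℕ.+ δ i 0 ℕ.* δ j n ℕ.+ δ j 0 ℕ.* δ i n

A-Cplus : (n : ℕ) → Mat (suc n)
A-Cplus n i j = + adjCount n (toℕ i) (toℕ j)

M-Cplus : (n : ℕ) → Vecℤ (suc n) → Mat (suc n)
M-Cplus n a i j = (if toℕ i ≡ᵇ toℕ j then a i else + 0) - A-Cplus n i j

InV : (n : ℕ) → ℤ → ℕ → Set
InV n r u = ∃ λ (a : Vecℤ (suc n)) →
  (∀ i → r ≤ a i) ×
  det (M-Cplus n a) ≡ + u ×
  (u ≢ 0 → PosDef (M-Cplus n a)) ×
  (u ≡ 0 → PosSemiDef (M-Cplus n a) × RankPred (M-Cplus n a)) ×
  PhiCyclic (M-Cplus n a)

-- The matrix M = M_G(a) is symmetric and its first-row cofactor vector c satisfies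
-- M c = (det M) e₀, so x₀ · det M = Σⱼ (M x)ⱼ cⱼ for every x.  The cofactor c₀ is the
-- (0,0) minor: G minus vertex 0 is a path plus an isolated vertex, so c₀ = aₙ times a continuant.
-- For u = 1 take a = (2, 3, 2, …, 2) and a positive w with M w = e₀ and w₀ = c₀: then det M = 1.
-- For n ≥ 8 vary one weight a_j = t around a positive z with z_j = 1, M(β) z = 0 and c₀(β) = z₀²:
-- the cofactor vector of M(β) is z₀ z, hence det M(t) = t − β and t = β + u gives every u ≥ 0.
-- Writing X = z Y, the quadratic form of M is Σ_edges z_k z_l (Y_k − Y_l)² + Σᵢ zᵢ (M z)ᵢ Yᵢ²,
-- which gives positivity whenever M z ≥ 0.  Finally det M(β + 1) = 1 makes ℤⁿ / Im M(t)
-- cyclic, generated by e_j, and the torsion subgroup of a cyclic group is cyclic.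

module Submission where

open import Defs
open import Data.Nat using (ℕ; _≤_)
open import Data.Integer using (+_)
open import Data.Product using (_×_)

open import Data.Bool using (Bool; true; false; if_then_else_)
open import Data.Empty using (⊥-elim)
open import Data.Fin using (Fin; toℕ; fromℕ<; punchIn) renaming (zero to fzero; suc to fsuc)
open import Data.Fin.Properties using (toℕ<n; toℕ-fromℕ<)
open import Data.Integer as ℤ using (ℤ; _+_; _*_; -_; _-_)
import Data.Integer.Properties as ℤP
open import Data.Integer.Tactic.RingSolver using (solve-∀)
open import Data.Nat as ℕ using (zero; suc; z≤n; s≤s; _≡ᵇ_; _∸_)
import Data.Nat.Properties as ℕP
import Data.Nat.Tactic.RingSolver as ℕSolver
open import Data.Product using (∃; _,_; proj₁; proj₂)
open import Data.Sum using (_⊎_; inj₁; inj₂; reduce)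
open import Function using (_∘_)
open import Relation.Binary.Definitions using (tri<; tri≈; tri>)
open import Relation.Binary.PropositionalEquality
open import Relation.Nullary using (Dec; yes; no)
open ≡-Reasoning

nonzero-cancel : ∀ (p q : ℤ) → p ≢ + 0 → p * q ≡ + 0 → q ≡ + 0
nonzero-cancel p q p≢0 pq≡0 with ℤP.i*j≡0⇒i≡0∨j≡0 p pq≡0
... | inj₁ p≡0 = ⊥-elim (p≢0 p≡0)
... | inj₂ q≡0 = q≡0

0≤i*i : ∀ i → + 0 ℤ.≤ i * i
0≤i*i (+ n) = subst (+ 0 ℤ.≤_) (ℤP.pos-* n n) (ℤ.+≤+ z≤n)
0≤i*i ℤ.-[1+ n ] = ℤ.+≤+ z≤n

0<i*j : ∀ i j → + 0 ℤ.< i → + 0 ℤ.< j → + 0 ℤ.< i * j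
0<i*j (+ suc n) (+ suc m) _ _ = ℤ.+<+ (s≤s z≤n)
0<i*j (+ zero) _ (ℤ.+<+ ()) _
0<i*j (+ suc n) (+ zero) _ (ℤ.+<+ ())

0≤i*j : ∀ i j → + 0 ℤ.≤ i → + 0 ℤ.≤ j → + 0 ℤ.≤ i * j
0≤i*j (+ n) (+ m) _ _ = subst (+ 0 ℤ.≤_) (ℤP.pos-* n m) (ℤ.+≤+ z≤n)

i*i≡0⇒i≡0 : ∀ i → i * i ≡ + 0 → i ≡ + 0
i*i≡0⇒i≡0 i i*i≡0 = reduce (ℤP.i*j≡0⇒i≡0∨j≡0 i i*i≡0)

0<i⇒i≢0 : ∀ i → + 0 ℤ.< i → i ≢ + 0
0<i⇒i≢0 i 0<i i≡0 = ℤP.<-irrefl (sym i≡0) 0<i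

i≢0⇒0<i*i : ∀ i → i ≢ + 0 → + 0 ℤ.< i * i
i≢0⇒0<i*i i i≢0 = ℤP.≤∧≢⇒< (0≤i*i i) (λ e → i≢0 (i*i≡0⇒i≡0 i (sym e)))

i*j≢0 : ∀ i j → i ≢ + 0 → j ≢ + 0 → i * j ≢ + 0
i*j≢0 i j i≢0 j≢0 = j≢0 ∘ nonzero-cancel i j i≢0

0≤i*j⇒0≤j : ∀ i j → + 0 ℤ.< i → + 0 ℤ.≤ i * j → + 0 ℤ.≤ j
0≤i*j⇒0≤j i (+ n) _ _ = ℤ.+≤+ z≤n
0≤i*j⇒0≤j (+ suc k) ℤ.-[1+ n ] _ ()
0≤i*j⇒0≤j (+ zero) ℤ.-[1+ n ] (ℤ.+<+ ()) _

nonneg-+≡0ˡ : ∀ i j → + 0 ℤ.≤ i → + 0 ℤ.≤ j → i + j ≡ + 0 → i ≡ + 0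
nonneg-+≡0ˡ i j 0≤i 0≤j i+j≡0 =
  ℤP.≤-antisym (subst (i ℤ.≤_) i+j≡0 (subst (ℤ._≤ i + j) (ℤP.+-identityʳ i) (ℤP.+-monoʳ-≤ i 0≤j))) 0≤i

nonneg-+≡0ʳ : ∀ i j → + 0 ℤ.≤ i → + 0 ℤ.≤ j → i + j ≡ + 0 → j ≡ + 0
nonneg-+≡0ʳ i j 0≤i 0≤j i+j≡0 = nonneg-+≡0ˡ j i 0≤j 0≤i (trans (ℤP.+-comm j i) i+j≡0)

0<c*x+suc : ∀ c (x : ℤ) d → + 0 ℤ.≤ x → + 0 ℤ.< + c * x + + suc d
0<c*x+suc c x d 0≤x = ℤP.+-mono-≤-< (0≤i*j (+ c) x (ℤ.+≤+ z≤n) 0≤x) (ℤ.+<+ (s≤s z≤n))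

-- Sums over initial segments of ℕ

punchInℕ : ℕ → ℕ → ℕ
punchInℕ zero c = suc c
punchInℕ (suc i) zero = zero
punchInℕ (suc i) (suc c) = suc (punchInℕ i c)

-- A left inverse of punchInℕ i; its value at i is junk.
punchOutℕ : ℕ → ℕ → ℕ
punchOutℕ zero zero = zero
punchOutℕ zero (suc c) = c
punchOutℕ (suc i) zero = zero
punchOutℕ (suc i) (suc c) = suc (punchOutℕ i c)

punchOutℕ-punchInℕ : ∀ i k → punchOutℕ i (punchInℕ i k) ≡ k
punchOutℕ-punchInℕ zero k = refl
punchOutℕ-punchInℕ (suc i) zero = refl
punchOutℕ-punchInℕ (suc i) (suc k) = cong suc (punchOutℕ-punchInℕ i k)

punchInℕᵢ≢i : ∀ i k → punchInℕ i k ≢ i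
punchInℕᵢ≢i zero k ()
punchInℕᵢ≢i (suc i) zero ()
punchInℕᵢ≢i (suc i) (suc k) e = punchInℕᵢ≢i i k (ℕP.suc-injective e)

punchInℕ≤suc : ∀ i c → punchInℕ i c ℕ.≤ suc c
punchInℕ≤suc zero c = ℕP.≤-refl
punchInℕ≤suc (suc i) zero = z≤n
punchInℕ≤suc (suc i) (suc c) = s≤s (punchInℕ≤suc i c)

punchInℕ-comm : ∀ i j c → i ≢ j →
  punchInℕ i (punchInℕ (punchOutℕ i j) c) ≡ punchInℕ j (punchInℕ (punchOutℕ j i) c)
punchInℕ-comm zero zero c i≢j = ⊥-elim (i≢j refl)
punchInℕ-comm zero (suc j) c i≢j = refl
punchInℕ-comm (suc i) zero c i≢j = refl
punchInℕ-comm (suc i) (suc j) zero i≢j = refl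
punchInℕ-comm (suc i) (suc j) (suc c) i≢j = cong suc (punchInℕ-comm i j c (i≢j ∘ cong suc))

toℕ-punchIn : ∀ {m} (i : Fin (suc m)) (j : Fin m) → toℕ (punchIn i j) ≡ punchInℕ (toℕ i) (toℕ j)
toℕ-punchIn fzero j = refl
toℕ-punchIn (fsuc i) fzero = refl
toℕ-punchIn (fsuc i) (fsuc j) = cong suc (toℕ-punchIn i j)

-- Opaque, so that unification can recover g from sumℤ (suc N) g.
opaque
  sumℤ : ℕ → (ℕ → ℤ) → ℤ
  sumℤ zero g = + 0
  sumℤ (suc N) g = g 0 + sumℤ N (λ k → g (suc k))

  sumℤ-suc : ∀ N (g : ℕ → ℤ) → sumℤ (suc N) g ≡ g 0 + sumℤ N (λ k → g (suc k))
  sumℤ-suc N g = refl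

  sumℤ-cong : ∀ N {g h : ℕ → ℤ} → (∀ k → k ℕ.< N → g k ≡ h k) → sumℤ N g ≡ sumℤ N h
  sumℤ-cong zero e = refl
  sumℤ-cong (suc N) e = cong₂ _+_ (e 0 (s≤s z≤n)) (sumℤ-cong N (λ k k<N → e (suc k) (s≤s k<N)))

  sumℤ-zero : ∀ N {g : ℕ → ℤ} → (∀ k → k ℕ.< N → g k ≡ + 0) → sumℤ N g ≡ + 0
  sumℤ-zero zero e = refl
  sumℤ-zero (suc N) e = cong₂ _+_ (e 0 (s≤s z≤n)) (sumℤ-zero N (λ k k<N → e (suc k) (s≤s k<N)))

  sumℤ-+ : ∀ N (g h : ℕ → ℤ) → sumℤ N (λ k → g k + h k) ≡ sumℤ N g + sumℤ N h
  sumℤ-+ zero g h = refl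
  sumℤ-+ (suc N) g h =
    trans (cong (_+_ (g 0 + h 0)) (sumℤ-+ N _ _)) (interchange (g 0) (h 0) (sumℤ N _) (sumℤ N _))
    where interchange : ∀ a b c d → a + b + (c + d) ≡ a + c + (b + d)
          interchange = solve-∀

  sumℤ-*ˡ : ∀ N (c : ℤ) (g : ℕ → ℤ) → c * sumℤ N g ≡ sumℤ N (λ k → c * g k)
  sumℤ-*ˡ zero c g = ℤP.*-zeroʳ c
  sumℤ-*ˡ (suc N) c g =
    trans (ℤP.*-distribˡ-+ c (g 0) _) (cong (_+_ (c * g 0)) (sumℤ-*ˡ N c (λ k → g (suc k))))

  sumℤ-neg : ∀ N (g : ℕ → ℤ) → - sumℤ N g ≡ sumℤ N (λ k → - g k)
  sumℤ-neg zero g = refl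
  sumℤ-neg (suc N) g =
    trans (ℤP.neg-distrib-+ (g 0) _) (cong (_+_ (- g 0)) (sumℤ-neg N (λ k → g (suc k))))

  sumℤ-- : ∀ N (g h : ℕ → ℤ) → sumℤ N (λ k → g k - h k) ≡ sumℤ N g - sumℤ N h
  sumℤ-- N g h = trans (sumℤ-+ N g (λ k → - h k)) (cong (_+_ (sumℤ N g)) (sym (sumℤ-neg N h)))

  sumℤ-last : ∀ N (g : ℕ → ℤ) → sumℤ (suc N) g ≡ sumℤ N g + g N
  sumℤ-last zero g = trans (ℤP.+-identityʳ (g 0)) (sym (ℤP.+-identityˡ (g 0)))
  sumℤ-last (suc N) g =
    trans (cong (_+_ (g 0)) (sumℤ-last N (λ k → g (suc k)))) (sym (ℤP.+-assoc (g 0) _ _))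

  sumℤ-swap : ∀ N M (F : ℕ → ℕ → ℤ) →
    sumℤ N (λ i → sumℤ M (F i)) ≡ sumℤ M (λ j → sumℤ N (λ i → F i j))
  sumℤ-swap zero M F = sym (sumℤ-zero M (λ _ _ → refl))
  sumℤ-swap (suc N) M F =
    trans (cong (_+_ (sumℤ M (F 0))) (sumℤ-swap N M (λ i → F (suc i))))
          (sym (sumℤ-+ M (F 0) (λ j → sumℤ N (λ i → F (suc i) j))))

  sumℤ-single : ∀ N c (g : ℕ → ℤ) → c ℕ.< N → (∀ k → k ℕ.< N → k ≢ c → g k ≡ + 0) →
    sumℤ N g ≡ g c
  sumℤ-single (suc N) zero g _ e =
    trans (cong (_+_ (g 0)) (sumℤ-zero N (λ k k<N → e (suc k) (s≤s k<N) (λ ()))))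
          (ℤP.+-identityʳ (g 0))
  sumℤ-single (suc N) (suc c) g (s≤s c<N) e =
    trans (cong (_+ sumℤ N (λ k → g (suc k))) (e 0 (s≤s z≤n) (λ ())))
    (trans (ℤP.+-identityˡ _)
           (sumℤ-single N c (λ k → g (suc k)) c<N
              (λ k k<N k≢c → e (suc k) (s≤s k<N) (λ eq → k≢c (ℕP.suc-injective eq)))))

  sumℤ-punchInℕ : ∀ N j (g : ℕ → ℤ) → j ℕ.< suc N →
    sumℤ N (λ k → g (punchInℕ j k)) ≡ sumℤ (suc N) g - g j
  sumℤ-punchInℕ N zero g _ = add-sub (g 0) _
    where add-sub : ∀ a b → b ≡ a + b - a
          add-sub = solve-∀
  sumℤ-punchInℕ (suc N) (suc j) g (s≤s j<) =
    trans (cong (_+_ (g 0)) (sumℤ-punchInℕ N j (λ k → g (suc k)) j<)) (+-assoc-sub (g 0) _ _)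
    where +-assoc-sub : ∀ a b c → a + (b - c) ≡ a + b - c
          +-assoc-sub = solve-∀

  sum-toℕ : ∀ m (f : Fin m → ℤ) (g : ℕ → ℤ) → (∀ i → f i ≡ g (toℕ i)) → Σ[ f ] ≡ sumℤ m g
  sum-toℕ zero f g e = refl
  sum-toℕ (suc m) f g e =
    cong₂ _+_ (e fzero) (sum-toℕ m (λ i → f (fsuc i)) (λ k → g (suc k)) (λ i → e (fsuc i)))

sumℤ-nonneg : ∀ N (g : ℕ → ℤ) → (∀ k → k ℕ.< N → + 0 ℤ.≤ g k) → + 0 ℤ.≤ sumℤ N g
sumℤ-nonneg zero g _ = subst (+ 0 ℤ.≤_) (sym (sumℤ-zero 0 (λ _ ()))) ℤP.≤-refl
sumℤ-nonneg (suc N) g 0≤g = subst (+ 0 ℤ.≤_) (sym (sumℤ-suc N g))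
  (ℤP.+-mono-≤ (0≤g 0 (s≤s z≤n)) (sumℤ-nonneg N (λ k → g (suc k)) (λ k k< → 0≤g (suc k) (s≤s k<))))

sumℤ-nonneg≡0 : ∀ N (g : ℕ → ℤ) → (∀ k → k ℕ.< N → + 0 ℤ.≤ g k) → sumℤ N g ≡ + 0 →
  ∀ k → k ℕ.< N → g k ≡ + 0
sumℤ-nonneg≡0 (suc N) g 0≤g Σ≡0 = λ where
    zero _ → nonneg-+≡0ˡ (g 0) _ (0≤g 0 (s≤s z≤n)) 0≤tail head+tail≡0
    (suc k) (s≤s k<) → sumℤ-nonneg≡0 N (λ k → g (suc k)) (λ k k< → 0≤g (suc k) (s≤s k<))
      (nonneg-+≡0ʳ (g 0) _ (0≤g 0 (s≤s z≤n)) 0≤tail head+tail≡0) k k<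
  where
  0≤tail = sumℤ-nonneg N (λ k → g (suc k)) (λ k k< → 0≤g (suc k) (s≤s k<))
  head+tail≡0 = trans (sym (sumℤ-suc N g)) Σ≡0

-- Determinants of ℕ-indexed matrices

sign-suc : ∀ k → sign (suc k) ≡ - sign k
sign-suc zero = refl
sign-suc (suc k) = trans (sym (ℤP.neg-involutive (sign k))) (cong -_ (sym (sign-suc k)))

sign*sign : ∀ k → sign k * sign k ≡ + 1
sign*sign zero = refl
sign*sign (suc zero) = refl
sign*sign (suc (suc k)) = sign*sign k

sign-punchOutℕ : ∀ i j → i ≢ j →
  sign i * sign (punchOutℕ i j) ≡ - (sign j * sign (punchOutℕ j i))
sign-punchOutℕ zero zero i≢j = ⊥-elim (i≢j refl)
sign-punchOutℕ zero (suc j) _ rewrite sign-suc j = ring (sign j)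
  where ring : ∀ s → + 1 * s ≡ - (- s * + 1)
        ring = solve-∀
sign-punchOutℕ (suc i) zero _ rewrite sign-suc i = ring (sign i)
  where ring : ∀ s → - s * + 1 ≡ - (+ 1 * s)
        ring = solve-∀
sign-punchOutℕ (suc i) (suc j) i≢j
  rewrite sign-suc i | sign-suc (punchOutℕ i j) | sign-suc j | sign-suc (punchOutℕ j i) =
  trans (neg*neg (sign i) _) (trans (sign-punchOutℕ i j (i≢j ∘ cong suc)) (cong -_ (sym (neg*neg (sign j) _))))
  where neg*neg : ∀ a b → - a * - b ≡ a * b
        neg*neg = solve-∀

Matℕ : Set
Matℕ = ℕ → ℕ → ℤ

minorℕ : ℕ → Matℕ → Matℕ
minorℕ j f r c = f (suc r) (punchInℕ j c)

-- Only the top-left m×m corner of f is read by detℕ m f.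
detℕ : ℕ → Matℕ → ℤ
detℕ zero f = + 1
detℕ (suc m) f = sumℤ (suc m) (λ j → sign j * (f 0 j * detℕ m (minorℕ j f)))

detℕ-cong : ∀ m {f g : Matℕ} → (∀ r c → r ℕ.< m → c ℕ.< m → f r c ≡ g r c) → detℕ m f ≡ detℕ m g
detℕ-cong zero e = refl
detℕ-cong (suc m) e = sumℤ-cong (suc m) (λ j j< →
  cong (sign j *_) (cong₂ _*_ (e 0 j (s≤s z≤n) j<)
    (detℕ-cong m (λ r c r< c< →
      e (suc r) (punchInℕ j c) (s≤s r<) (ℕP.≤-trans (s≤s (punchInℕ≤suc j c)) (s≤s c<))))))

det-toℕ : ∀ m (M : Mat m) (f : Matℕ) → (∀ i j → M i j ≡ f (toℕ i) (toℕ j)) → det M ≡ detℕ m f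
det-toℕ zero M f e = refl
det-toℕ (suc m) M f e = sum-toℕ (suc m) _ _ (λ j →
  cong (sign (toℕ j) *_) (cong₂ _*_ (e fzero j)
    (det-toℕ m (minor fzero j M) (minorℕ (toℕ j) f) (λ k l →
      trans (e (fsuc k) (punchIn j l)) (cong (f (suc (toℕ k))) (toℕ-punchIn j l))))))

-- The transposition of s and s + 1.
swapℕ : ℕ → ℕ → ℕ
swapℕ zero zero = 1
swapℕ zero (suc zero) = 0
swapℕ zero (suc (suc k)) = suc (suc k)
swapℕ (suc s) zero = zero
swapℕ (suc s) (suc k) = suc (swapℕ s k)

permuteRows : (ℕ → ℕ) → Matℕ → Matℕ
permuteRows σ f r = f (σ r)

detℕ-expand-rows01 : ∀ m f → detℕ (suc (suc m)) f ≡
  sumℤ (suc (suc m)) (λ j → sumℤ (suc m) (λ k →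
    sign j * sign k * (f 0 j * f 1 (punchInℕ j k)) * detℕ m (minorℕ k (minorℕ j f))))
detℕ-expand-rows01 m f = sumℤ-cong (suc (suc m)) λ j _ → begin
  sign j * (f 0 j * sumℤ (suc m) (λ k → sign k * (f 1 (punchInℕ j k) * D j k)))
    ≡⟨ cong (sign j *_) (sumℤ-*ˡ (suc m) (f 0 j) _) ⟩
  sign j * sumℤ (suc m) (λ k → f 0 j * (sign k * (f 1 (punchInℕ j k) * D j k)))
    ≡⟨ sumℤ-*ˡ (suc m) (sign j) _ ⟩
  sumℤ (suc m) (λ k → sign j * (f 0 j * (sign k * (f 1 (punchInℕ j k) * D j k))))
    ≡⟨ sumℤ-cong (suc m) (λ k _ → reassoc (sign j) (sign k) (f 0 j) (f 1 (punchInℕ j k)) (D j k)) ⟩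
  sumℤ (suc m) (λ k → sign j * sign k * (f 0 j * f 1 (punchInℕ j k)) * D j k) ∎
  where
  D : ℕ → ℕ → ℤ
  D j k = detℕ m (minorℕ k (minorℕ j f))
  reassoc : ∀ a b c d e → a * (c * (b * (d * e))) ≡ a * b * (c * d) * e
  reassoc = solve-∀

-- Both sides sum F over the ordered pairs of distinct indices below suc N.
sumℤ-distinct-pairs : ∀ N (F : ℕ → ℕ → ℤ) →
  sumℤ (suc N) (λ j → sumℤ N (λ k → F j (punchInℕ j k))) ≡
  sumℤ (suc N) (λ j → sumℤ N (λ k → F (punchInℕ j k) j))
sumℤ-distinct-pairs N F = begin
  sumℤ (suc N) (λ j → sumℤ N (λ k → F j (punchInℕ j k)))
    ≡⟨ sumℤ-cong (suc N) (λ j j< → sumℤ-punchInℕ N j (F j) j<) ⟩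
  sumℤ (suc N) (λ j → sumℤ (suc N) (F j) - F j j)
    ≡⟨ sumℤ-- (suc N) _ _ ⟩
  sumℤ (suc N) (λ j → sumℤ (suc N) (F j)) - diagonal
    ≡⟨ cong (_- diagonal) (sumℤ-swap (suc N) (suc N) F) ⟩
  sumℤ (suc N) (λ j → sumℤ (suc N) (λ i → F i j)) - diagonal
    ≡⟨ sym (sumℤ-- (suc N) _ _) ⟩
  sumℤ (suc N) (λ j → sumℤ (suc N) (λ i → F i j) - F j j)
    ≡⟨ sumℤ-cong (suc N) (λ j j< → sym (sumℤ-punchInℕ N j (λ i → F i j) j<)) ⟩
  sumℤ (suc N) (λ j → sumℤ N (λ k → F (punchInℕ j k) j)) ∎
  where diagonal = sumℤ (suc N) (λ j → F j j)

-- The term of the two-row expansion of det f that uses the entries f 0 j and f 1 j′.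
pairTerm : ℕ → Matℕ → ℕ → ℕ → ℤ
pairTerm m f j j′ = sign j * sign (punchOutℕ j j′) * (f 0 j * f 1 j′) * detℕ m (minorℕ (punchOutℕ j j′) (minorℕ j f))

pairTerm-punchInℕ : ∀ m f j k → pairTerm m f j (punchInℕ j k) ≡
  sign j * sign k * (f 0 j * f 1 (punchInℕ j k)) * detℕ m (minorℕ k (minorℕ j f))
pairTerm-punchInℕ m f j k rewrite punchOutℕ-punchInℕ j k = refl

pairTerm-swap01 : ∀ m f j k →
  sign j * sign k * (f 1 j * f 0 (punchInℕ j k)) * detℕ m (minorℕ k (minorℕ j f)) ≡ - pairTerm m f (punchInℕ j k) j
pairTerm-swap01 m f j k = begin
  sign j * sign k * (f 1 j * f 0 j′) * detℕ m (minorℕ k (minorℕ j f))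
    ≡⟨ cong (λ k′ → sign j * sign k′ * (f 1 j * f 0 j′) * detℕ m (minorℕ k′ (minorℕ j f)))
            (sym (punchOutℕ-punchInℕ j k)) ⟩
  sign j * sign (punchOutℕ j j′) * (f 1 j * f 0 j′) * E j j′
    ≡⟨ cong₂ (λ s e → s * (f 1 j * f 0 j′) * e) (sign-punchOutℕ j j′ j≢j′)
             (detℕ-cong m (λ r c _ _ → cong (f (suc (suc r))) (punchInℕ-comm j j′ c j≢j′))) ⟩
  - (sign j′ * sign (punchOutℕ j′ j)) * (f 1 j * f 0 j′) * E j′ j
    ≡⟨ ring (sign j′ * sign (punchOutℕ j′ j)) (f 1 j) (f 0 j′) (E j′ j) ⟩
  - pairTerm m f j′ j ∎
  where
  j′ = punchInℕ j k
  j≢j′ : j ≢ j′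
  j≢j′ e = punchInℕᵢ≢i j k (sym e)
  E : ℕ → ℕ → ℤ
  E j j′ = detℕ m (minorℕ (punchOutℕ j j′) (minorℕ j f))
  ring : ∀ s a b e → - s * (a * b) * e ≡ - (s * (b * a) * e)
  ring = solve-∀

detℕ-swap01 : ∀ m f → detℕ (suc (suc m)) (permuteRows (swapℕ 0) f) ≡ - detℕ (suc (suc m)) f
detℕ-swap01 m f = begin
  detℕ (suc (suc m)) (permuteRows (swapℕ 0) f)
    ≡⟨ detℕ-expand-rows01 m (permuteRows (swapℕ 0) f) ⟩
  sumℤ (suc (suc m)) (λ j → sumℤ (suc m) (λ k →
    sign j * sign k * (f 1 j * f 0 (punchInℕ j k)) * detℕ m (minorℕ k (minorℕ j f))))
    ≡⟨ sumℤ-cong (suc (suc m)) (λ j _ → sumℤ-cong (suc m) (λ k _ → pairTerm-swap01 m f j k)) ⟩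
  sumℤ (suc (suc m)) (λ j → sumℤ (suc m) (λ k → - G (punchInℕ j k) j))
    ≡⟨ sumℤ-cong (suc (suc m)) (λ j _ → sym (sumℤ-neg (suc m) _)) ⟩
  sumℤ (suc (suc m)) (λ j → - sumℤ (suc m) (λ k → G (punchInℕ j k) j))
    ≡⟨ sym (sumℤ-neg (suc (suc m)) _) ⟩
  - sumℤ (suc (suc m)) (λ j → sumℤ (suc m) (λ k → G (punchInℕ j k) j))
    ≡⟨ cong -_ (sym (sumℤ-distinct-pairs (suc m) G)) ⟩
  - sumℤ (suc (suc m)) (λ j → sumℤ (suc m) (λ k → G j (punchInℕ j k)))
    ≡⟨ cong -_ (trans (sumℤ-cong (suc (suc m)) (λ j _ → sumℤ-cong (suc m) (λ k _ → pairTerm-punchInℕ m f j k)))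
                      (sym (detℕ-expand-rows01 m f))) ⟩
  - detℕ (suc (suc m)) f ∎
  where G = pairTerm m f

detℕ-swap : ∀ s m f → suc s ℕ.< m → detℕ m (permuteRows (swapℕ s) f) ≡ - detℕ m f
detℕ-swap zero (suc zero) f (s≤s ())
detℕ-swap zero (suc (suc m)) f _ = detℕ-swap01 m f
detℕ-swap (suc s) (suc m) f (s≤s s<m) = begin
  sumℤ (suc m) (λ j → sign j * (f 0 j * detℕ m (permuteRows (swapℕ s) (minorℕ j f))))
    ≡⟨ sumℤ-cong (suc m) (λ j _ → cong (λ d → sign j * (f 0 j * d)) (detℕ-swap s m (minorℕ j f) s<m)) ⟩
  sumℤ (suc m) (λ j → sign j * (f 0 j * - detℕ m (minorℕ j f)))
    ≡⟨ sumℤ-cong (suc m) (λ j _ → ring (sign j) (f 0 j) _) ⟩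
  sumℤ (suc m) (λ j → - (sign j * (f 0 j * detℕ m (minorℕ j f))))
    ≡⟨ sym (sumℤ-neg (suc m) _) ⟩
  - detℕ (suc m) f ∎
  where ring : ∀ a b c → a * (b * - c) ≡ - (a * (b * c))
        ring = solve-∀

x≡-x⇒x≡0 : ∀ (x : ℤ) → x ≡ - x → x ≡ + 0
x≡-x⇒x≡0 x x≡-x = nonzero-cancel (+ 2) x (λ ()) (trans (double x) (trans (cong (_+_ x) x≡-x) (ℤP.+-inverseʳ x)))
  where double : ∀ x → + 2 * x ≡ x + x
        double = solve-∀

swapℕ-self : ∀ s → swapℕ s s ≡ suc s
swapℕ-self zero = refl
swapℕ-self (suc s) = cong suc (swapℕ-self s)

swapℕ-suc : ∀ s → swapℕ s (suc s) ≡ s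
swapℕ-suc zero = refl
swapℕ-suc (suc s) = cong suc (swapℕ-suc s)

swapℕ-< : ∀ s i → i ℕ.< s → swapℕ s i ≡ i
swapℕ-< (suc s) zero _ = refl
swapℕ-< (suc s) (suc i) (s≤s i<s) = cong suc (swapℕ-< s i i<s)

swapℕ-> : ∀ s i → suc s ℕ.< i → swapℕ s i ≡ i
swapℕ-> zero (suc zero) (s≤s ())
swapℕ-> zero (suc (suc i)) _ = refl
swapℕ-> (suc s) (suc i) (s≤s s<i) = cong suc (swapℕ-> s i s<i)

detℕ-row0≡row : ∀ r m f → suc r ℕ.< m → (∀ c → f 0 c ≡ f (suc r) c) → detℕ m f ≡ + 0
detℕ-row0≡row zero (suc zero) f (s≤s ()) e
detℕ-row0≡row zero (suc (suc m)) f _ e =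
  x≡-x⇒x≡0 _ (trans (sym (detℕ-cong (suc (suc m)) (λ r c _ _ → swapped≗f r c))) (detℕ-swap01 m f))
  where swapped≗f : ∀ r c → permuteRows (swapℕ 0) f r c ≡ f r c
        swapped≗f zero c = sym (e c)
        swapped≗f (suc zero) c = e c
        swapped≗f (suc (suc r)) c = refl
detℕ-row0≡row (suc r) m f r<m e = begin
  detℕ m f
    ≡⟨ sym (ℤP.neg-involutive _) ⟩
  - - detℕ m f
    ≡⟨ cong -_ (sym (detℕ-swap (suc r) m f r<m)) ⟩
  - detℕ m (permuteRows (swapℕ (suc r)) f)
    ≡⟨ cong -_ (detℕ-row0≡row r m (permuteRows (swapℕ (suc r)) f) (ℕP.<-trans (ℕP.n<1+n (suc r)) r<m) row0≡row) ⟩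
  + 0 ∎
  where row0≡row : ∀ c → f 0 c ≡ f (swapℕ (suc r) (suc r)) c
        row0≡row c = trans (e c) (cong (λ q → f q c) (sym (cong suc (swapℕ-self r))))

cofactor : ℕ → Matℕ → ℕ → ℤ
cofactor m f j = sign j * detℕ m (minorℕ j f)

laplace-row0 : ∀ m f → sumℤ (suc m) (λ j → f 0 j * cofactor m f j) ≡ detℕ (suc m) f
laplace-row0 m f = sumℤ-cong (suc m) (λ j _ → *-left-comm (f 0 j) (sign j) _)
  where *-left-comm : ∀ a b c → a * (b * c) ≡ b * (a * c)
        *-left-comm = solve-∀

replaceRow0 : ℕ → Matℕ → Matℕ
replaceRow0 r f zero = f r
replaceRow0 r f (suc i) = f (suc i)

cofactor-orthogonal : ∀ m f r → suc r ℕ.< suc m →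
  sumℤ (suc m) (λ j → f (suc r) j * cofactor m f j) ≡ + 0
cofactor-orthogonal m f r r< =
  trans (laplace-row0 m (replaceRow0 (suc r) f)) (detℕ-row0≡row r (suc m) (replaceRow0 (suc r) f) r< (λ c → refl))

-- rotℕ r moves row r to the top and keeps the order of the other rows.
rotℕ : ℕ → ℕ → ℕ
rotℕ zero i = i
rotℕ (suc r) i = swapℕ r (rotℕ r i)

detℕ-rot : ∀ r m f → r ℕ.< m → detℕ m (permuteRows (rotℕ r) f) ≡ sign r * detℕ m f
detℕ-rot zero m f _ = sym (ℤP.*-identityˡ _)
detℕ-rot (suc r) m f r< = begin
  detℕ m (permuteRows (rotℕ r) (permuteRows (swapℕ r) f))
    ≡⟨ detℕ-rot r m (permuteRows (swapℕ r) f) (ℕP.<-trans (ℕP.n<1+n r) r<) ⟩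
  sign r * detℕ m (permuteRows (swapℕ r) f)
    ≡⟨ cong (sign r *_) (detℕ-swap r m f r<) ⟩
  sign r * - detℕ m f
    ≡⟨ sym (ℤP.neg-distribʳ-* (sign r) _) ⟩
  - (sign r * detℕ m f)
    ≡⟨ ℤP.neg-distribˡ-* (sign r) _ ⟩
  - sign r * detℕ m f
    ≡⟨ cong (_* detℕ m f) (sym (sign-suc r)) ⟩
  sign (suc r) * detℕ m f ∎

rotℕ-0 : ∀ r → rotℕ r 0 ≡ r
rotℕ-0 zero = refl
rotℕ-0 (suc r) = trans (cong (swapℕ r) (rotℕ-0 r)) (swapℕ-self r)

rotℕ-> : ∀ r i → r ℕ.< i → rotℕ r i ≡ i
rotℕ-> zero i _ = refl
rotℕ-> (suc r) i r<i = trans (cong (swapℕ r) (rotℕ-> r i (ℕP.<-trans (ℕP.n<1+n r) r<i))) (swapℕ-> r i r<i)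

rotℕ-< : ∀ r i → i ℕ.< r → rotℕ r (suc i) ≡ i
rotℕ-< (suc r) i (s≤s i≤r) with ℕP.m≤n⇒m<n∨m≡n i≤r
... | inj₁ i<r = trans (cong (swapℕ r) (rotℕ-< r i i<r)) (swapℕ-< r i i<r)
... | inj₂ refl = trans (cong (swapℕ i) (rotℕ-> i (suc i) (ℕP.n<1+n i))) (swapℕ-suc i)

cofactorAt : ℕ → ℕ → Matℕ → ℕ → ℤ
cofactorAt m r f j = sign r * cofactor m (permuteRows (rotℕ r) f) j

laplace-rotated : ∀ m f r i → sumℤ (suc m) (λ j → f i j * cofactorAt m r f j) ≡
  sign r * sumℤ (suc m) (λ j → f i j * cofactor m (permuteRows (rotℕ r) f) j)
laplace-rotated m f r i = begin
  sumℤ (suc m) (λ j → f i j * (sign r * c j))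
    ≡⟨ sumℤ-cong (suc m) (λ j _ → *-left-comm (f i j) (sign r) (c j)) ⟩
  sumℤ (suc m) (λ j → sign r * (f i j * c j))
    ≡⟨ sym (sumℤ-*ˡ (suc m) (sign r) _) ⟩
  sign r * sumℤ (suc m) (λ j → f i j * c j) ∎
  where
  c = cofactor m (permuteRows (rotℕ r) f)
  *-left-comm : ∀ a b c → a * (b * c) ≡ b * (a * c)
  *-left-comm = solve-∀

laplace-row : ∀ m f r → r ℕ.< suc m → sumℤ (suc m) (λ j → f r j * cofactorAt m r f j) ≡ detℕ (suc m) f
laplace-row m f r r< = begin
  sumℤ (suc m) (λ j → f r j * cofactorAt m r f j)
    ≡⟨ laplace-rotated m f r r ⟩
  sign r * sumℤ (suc m) (λ j → f r j * c j)
    ≡⟨ cong (λ q → sign r * sumℤ (suc m) (λ j → f q j * c j)) (sym (rotℕ-0 r)) ⟩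
  sign r * sumℤ (suc m) (λ j → permuteRows (rotℕ r) f 0 j * c j)
    ≡⟨ cong (sign r *_) (trans (laplace-row0 m (permuteRows (rotℕ r) f)) (detℕ-rot r (suc m) f r<)) ⟩
  sign r * (sign r * detℕ (suc m) f)
    ≡⟨ sym (ℤP.*-assoc (sign r) _ _) ⟩
  sign r * sign r * detℕ (suc m) f
    ≡⟨ cong (_* detℕ (suc m) f) (sign*sign r) ⟩
  + 1 * detℕ (suc m) f
    ≡⟨ ℤP.*-identityˡ _ ⟩
  detℕ (suc m) f ∎
  where c = cofactor m (permuteRows (rotℕ r) f)

-- Row i of f is one of the lower rows of the rotated matrix.
laplace-row-other : ∀ m f r i → r ℕ.< suc m → i ℕ.< suc m → i ≢ r →
  sumℤ (suc m) (λ j → f i j * cofactorAt m r f j) ≡ + 0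
laplace-row-other m f r i r< i< i≢r =
  trans (laplace-rotated m f r i) (trans (cong (sign r *_) (lower-row i i< i≢r)) (ℤP.*-zeroʳ (sign r)))
  where
  c = cofactor m (permuteRows (rotℕ r) f)
  lower-row : ∀ i → i ℕ.< suc m → i ≢ r → sumℤ (suc m) (λ j → f i j * c j) ≡ + 0
  lower-row i i< i≢r with ℕP.<-cmp i r
  ... | tri< i<r _ _ =
    trans (sumℤ-cong (suc m) (λ j _ → cong (λ q → f q j * c j) (sym (rotℕ-< r i i<r))))
          (cofactor-orthogonal m (permuteRows (rotℕ r) f) i (ℕP.≤-trans (s≤s i<r) r<))
  ... | tri≈ _ i≡r _ = ⊥-elim (i≢r i≡r)
  lower-row (suc i) (s≤s i<m) _ | tri> _ _ r<i =
    trans (sumℤ-cong (suc m) (λ j _ → cong (λ q → f q j * c j) (sym (rotℕ-> r (suc i) r<i))))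
          (cofactor-orthogonal m (permuteRows (rotℕ r) f) i (s≤s i<m))

matVec : ℕ → Matℕ → (ℕ → ℤ) → ℕ → ℤ
matVec N f x i = sumℤ N (λ j → f i j * x j)

adjugate : ℕ → Matℕ → (ℕ → ℤ) → ℕ → ℤ
adjugate m f y j = sumℤ (suc m) (λ r → y r * cofactorAt m r f j)

matVec-adjugate : ∀ m f y i → i ℕ.< suc m →
  matVec (suc m) f (adjugate m f y) i ≡ y i * detℕ (suc m) f
matVec-adjugate m f y i i< = begin
  sumℤ (suc m) (λ j → f i j * sumℤ (suc m) (λ r → y r * cofactorAt m r f j))
    ≡⟨ sumℤ-cong (suc m) (λ j _ → sumℤ-*ˡ (suc m) (f i j) (λ r → y r * cofactorAt m r f j)) ⟩
  sumℤ (suc m) (λ j → sumℤ (suc m) (λ r → f i j * (y r * cofactorAt m r f j)))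
    ≡⟨ sumℤ-swap (suc m) (suc m) (λ j r → f i j * (y r * cofactorAt m r f j)) ⟩
  sumℤ (suc m) (λ r → sumℤ (suc m) (λ j → f i j * (y r * cofactorAt m r f j)))
    ≡⟨ sumℤ-cong (suc m) (λ r _ → trans (sumℤ-cong (suc m) (λ j _ → *-left-comm (f i j) (y r) (cofactorAt m r f j)))
                                        (sym (sumℤ-*ˡ (suc m) (y r) (λ j → f i j * cofactorAt m r f j)))) ⟩
  sumℤ (suc m) (λ r → y r * sumℤ (suc m) (λ j → f i j * cofactorAt m r f j))
    ≡⟨ sumℤ-single (suc m) i _ i< (λ r r< r≢i →
         trans (cong (y r *_) (laplace-row-other m f r i r< i< (r≢i ∘ sym))) (ℤP.*-zeroʳ (y r))) ⟩
  y i * sumℤ (suc m) (λ j → f i j * cofactorAt m i f j)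
    ≡⟨ cong (y i *_) (laplace-row m f i i<) ⟩
  y i * detℕ (suc m) f ∎
  where *-left-comm : ∀ a b c → a * (b * c) ≡ b * (a * c)
        *-left-comm = solve-∀

detℕ≡1⇒surjective : ∀ m f → detℕ (suc m) f ≡ + 1 → ∀ y →
  ∃ λ x → ∀ i → i ℕ.< suc m → matVec (suc m) f x i ≡ y i
detℕ≡1⇒surjective m f det≡1 y = adjugate m f y , λ i i< →
  trans (matVec-adjugate m f y i i<) (trans (cong (y i *_) det≡1) (ℤP.*-identityʳ (y i)))

-- Symmetric matrices

Symmetricℕ : Matℕ → Set
Symmetricℕ f = ∀ r c → f r c ≡ f c r

matVec-lincomb : ∀ N f x y (p q : ℤ) i →
  matVec N f (λ k → p * x k - q * y k) i ≡ p * matVec N f x i - q * matVec N f y i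
matVec-lincomb N f x y p q i = begin
  sumℤ N (λ j → f i j * (p * x j - q * y j))
    ≡⟨ sumℤ-cong N (λ j _ → distrib (f i j) (x j) (y j) p q) ⟩
  sumℤ N (λ j → p * (f i j * x j) - q * (f i j * y j))
    ≡⟨ sumℤ-- N _ _ ⟩
  sumℤ N (λ j → p * (f i j * x j)) - sumℤ N (λ j → q * (f i j * y j))
    ≡⟨ sym (cong₂ _-_ (sumℤ-*ˡ N p _) (sumℤ-*ˡ N q _)) ⟩
  p * matVec N f x i - q * matVec N f y i ∎
  where distrib : ∀ a b c p q → a * (p * b - q * c) ≡ p * (a * b) - q * (a * c)
        distrib = solve-∀

pairing-symmetric : ∀ N f → Symmetricℕ f → ∀ y x →
  sumℤ N (λ i → y i * matVec N f x i) ≡ sumℤ N (λ j → matVec N f y j * x j)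
pairing-symmetric N f f-sym y x = begin
  sumℤ N (λ i → y i * sumℤ N (λ j → f i j * x j))
    ≡⟨ sumℤ-cong N (λ i _ → sumℤ-*ˡ N (y i) _) ⟩
  sumℤ N (λ i → sumℤ N (λ j → y i * (f i j * x j)))
    ≡⟨ sumℤ-swap N N _ ⟩
  sumℤ N (λ j → sumℤ N (λ i → y i * (f i j * x j)))
    ≡⟨ sumℤ-cong N (λ j _ → sumℤ-cong N (λ i _ → cong (λ e → y i * (e * x j)) (f-sym i j))) ⟩
  sumℤ N (λ j → sumℤ N (λ i → y i * (f j i * x j)))
    ≡⟨ sumℤ-cong N (λ j _ → sumℤ-cong N (λ i _ → rearrange (y i) (f j i) (x j))) ⟩
  sumℤ N (λ j → sumℤ N (λ i → x j * (f j i * y i)))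
    ≡⟨ sumℤ-cong N (λ j _ → trans (sym (sumℤ-*ˡ N (x j) _)) (ℤP.*-comm (x j) _)) ⟩
  sumℤ N (λ j → matVec N f y j * x j) ∎
  where rearrange : ∀ a b c → a * (b * c) ≡ c * (b * a)
        rearrange = solve-∀

-- Pairs d with the cofactors of row k: d k * det f = Σ_j (f d)_j C_kj, which vanishes.
symmetric-kernel-trivial : ∀ m f → Symmetricℕ f → detℕ (suc m) f ≢ + 0 → ∀ d →
  (∀ i → i ℕ.< suc m → matVec (suc m) f d i ≡ + 0) → ∀ k → k ℕ.< suc m → d k ≡ + 0
symmetric-kernel-trivial m f f-sym det≢0 d fd≡0 k k< =
  nonzero-cancel (detℕ (suc m) f) (d k) det≢0 (begin
    detℕ (suc m) f * d k
      ≡⟨ ℤP.*-comm _ (d k) ⟩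
    d k * detℕ (suc m) f
      ≡⟨ sym (cong (d k *_) (laplace-row m f k k<)) ⟩
    d k * matVec (suc m) f (cofactorAt m k f) k
      ≡⟨ sym (sumℤ-single (suc m) k _ k< (λ i i< i≢k →
           trans (cong (d i *_) (laplace-row-other m f k i k< i< i≢k)) (ℤP.*-zeroʳ (d i)))) ⟩
    sumℤ (suc m) (λ i → d i * matVec (suc m) f (cofactorAt m k f) i)
      ≡⟨ pairing-symmetric (suc m) f f-sym d (cofactorAt m k f) ⟩
    sumℤ (suc m) (λ j → matVec (suc m) f d j * cofactorAt m k f j)
      ≡⟨ sumℤ-zero (suc m) (λ j j< → trans (cong (_* cofactorAt m k f j) (fd≡0 j j<))
                                          (ℤP.*-zeroˡ (cofactorAt m k f j))) ⟩
    + 0 ∎)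

matVec-cofactor : ∀ m f i → i ℕ.< suc m →
  matVec (suc m) f (cofactor m f) i ≡ (if i ℕ.≡ᵇ 0 then detℕ (suc m) f else + 0)
matVec-cofactor m f zero _ = laplace-row0 m f
matVec-cofactor m f (suc r) r< = cofactor-orthogonal m f r r<

cofactor-pairing : ∀ m f → Symmetricℕ f → ∀ x →
  x 0 * detℕ (suc m) f ≡ sumℤ (suc m) (λ j → matVec (suc m) f x j * cofactor m f j)
cofactor-pairing m f f-sym x = begin
  x 0 * detℕ (suc m) f
    ≡⟨ sym (sumℤ-single (suc m) 0 _ (s≤s z≤n) off-diagonal) ⟩
  sumℤ (suc m) (λ i → x i * (if i ℕ.≡ᵇ 0 then detℕ (suc m) f else + 0))
    ≡⟨ sym (sumℤ-cong (suc m) (λ i i< → cong (x i *_) (matVec-cofactor m f i i<))) ⟩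
  sumℤ (suc m) (λ i → x i * matVec (suc m) f (cofactor m f) i)
    ≡⟨ pairing-symmetric (suc m) f f-sym x (cofactor m f) ⟩
  sumℤ (suc m) (λ j → matVec (suc m) f x j * cofactor m f j) ∎
  where
  off-diagonal : ∀ i → i ℕ.< suc m → i ≢ 0 → x i * (if i ℕ.≡ᵇ 0 then detℕ (suc m) f else + 0) ≡ + 0
  off-diagonal zero _ i≢0 = ⊥-elim (i≢0 refl)
  off-diagonal (suc i) _ _ = ℤP.*-zeroʳ (x (suc i))

-- If the (0,0) minor is invertible, a vector killed by all rows but the first is
-- determined by its first entry, so it is proportional to the cofactor vector.
cofactors-proportional : ∀ m f → Symmetricℕ f → detℕ (suc m) (minorℕ 0 f) ≢ + 0 → ∀ x →
  (∀ i → i ℕ.< suc m → matVec (suc (suc m)) f x (suc i) ≡ + 0) →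
  ∀ k → k ℕ.< suc (suc m) → x 0 * cofactor (suc m) f k ≡ cofactor (suc m) f 0 * x k
cofactors-proportional m f f-sym minor≢0 x fx≡0 k k< =
  ℤP.i-j≡0⇒i≡j _ _ (d≡0 k k<)
  where
  c = cofactor (suc m) f
  d : ℕ → ℤ
  d k = x 0 * c k - c 0 * x k
  d0≡0 : d 0 ≡ + 0
  d0≡0 = ℤP.i≡j⇒i-j≡0 (ℤP.*-comm (x 0) (c 0))
  fd≡0 : ∀ i → i ℕ.< suc m → matVec (suc (suc m)) f d (suc i) ≡ + 0
  fd≡0 i i< = begin
    matVec (suc (suc m)) f d (suc i)
      ≡⟨ matVec-lincomb (suc (suc m)) f c x (x 0) (c 0) (suc i) ⟩
    x 0 * matVec (suc (suc m)) f c (suc i) - c 0 * matVec (suc (suc m)) f x (suc i)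
      ≡⟨ cong₂ (λ p q → x 0 * p - c 0 * q) (cofactor-orthogonal (suc m) f i (s≤s i<)) (fx≡0 i i<) ⟩
    x 0 * + 0 - c 0 * + 0
      ≡⟨ zeros (x 0) (c 0) ⟩
    + 0 ∎
    where zeros : ∀ a b → a * + 0 - b * + 0 ≡ + 0
          zeros = solve-∀
  minor-kills-tail : ∀ i → i ℕ.< suc m → matVec (suc m) (minorℕ 0 f) (λ k → d (suc k)) i ≡ + 0
  minor-kills-tail i i< = begin
    matVec (suc m) (minorℕ 0 f) (λ k → d (suc k)) i
      ≡⟨ sym (ℤP.+-identityˡ _) ⟩
    + 0 + matVec (suc m) (minorℕ 0 f) (λ k → d (suc k)) i
      ≡⟨ cong (_+ matVec (suc m) (minorℕ 0 f) (λ k → d (suc k)) i)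
              (sym (trans (cong (f (suc i) 0 *_) d0≡0) (ℤP.*-zeroʳ (f (suc i) 0)))) ⟩
    f (suc i) 0 * d 0 + matVec (suc m) (minorℕ 0 f) (λ k → d (suc k)) i
      ≡⟨ sym (sumℤ-suc (suc m) (λ j → f (suc i) j * d j)) ⟩
    matVec (suc (suc m)) f d (suc i)
      ≡⟨ fd≡0 i i< ⟩
    + 0 ∎
  d≡0 : ∀ k → k ℕ.< suc (suc m) → d k ≡ + 0
  d≡0 zero _ = d0≡0
  d≡0 (suc k) (s≤s k<) = symmetric-kernel-trivial m (minorℕ 0 f) (λ r c → f-sym (suc r) (suc c))
    minor≢0 (λ k → d (suc k)) minor-kills-tail k k<

cofactor-cong : ∀ m f g j → (∀ r c → r ℕ.< m → c ℕ.< suc m → c ≢ j → f (suc r) c ≡ g (suc r) c) →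
  cofactor m f j ≡ cofactor m g j
cofactor-cong m f g j e = cong (sign j *_) (detℕ-cong m (λ r c r< c< →
  e r (punchInℕ j c) r< (ℕP.≤-trans (s≤s (punchInℕ≤suc j c)) (s≤s c<)) (punchInℕᵢ≢i j c)))

-- Tridiagonal matrices and continuants

detℕ-single-top-term : ∀ m g → (∀ j → j ℕ.< m → g 0 (suc j) * detℕ m (minorℕ (suc j) g) ≡ + 0) →
  detℕ (suc m) g ≡ g 0 0 * detℕ m (minorℕ 0 g)
detℕ-single-top-term m g rest≡0 = begin
  detℕ (suc m) g
    ≡⟨ sumℤ-suc m _ ⟩
  sign 0 * (g 0 0 * detℕ m (minorℕ 0 g)) + sumℤ m (λ j → sign (suc j) * (g 0 (suc j) * detℕ m (minorℕ (suc j) g)))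
    ≡⟨ cong₂ _+_ (ℤP.*-identityˡ (g 0 0 * detℕ m (minorℕ 0 g)))
                 (sumℤ-zero m (λ j j< → trans (cong (sign (suc j) *_) (rest≡0 j j<)) (ℤP.*-zeroʳ (sign (suc j))))) ⟩
  g 0 0 * detℕ m (minorℕ 0 g) + + 0
    ≡⟨ ℤP.+-identityʳ (g 0 0 * detℕ m (minorℕ 0 g)) ⟩
  g 0 0 * detℕ m (minorℕ 0 g) ∎

detℕ-first-column : ∀ m g → (∀ r → r ℕ.< m → g (suc r) 0 ≡ + 0) →
  detℕ (suc m) g ≡ g 0 0 * detℕ m (minorℕ 0 g)
detℕ-first-column zero g _ = detℕ-single-top-term zero g (λ _ ())
detℕ-first-column (suc m) g col = detℕ-single-top-term (suc m) g λ j _ → begin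
  g 0 (suc j) * detℕ (suc m) (minorℕ (suc j) g)
    ≡⟨ cong (g 0 (suc j) *_) (detℕ-first-column m (minorℕ (suc j) g) (λ r r< → col (suc r) (s≤s r<))) ⟩
  g 0 (suc j) * (g 1 0 * detℕ m (minorℕ 0 (minorℕ (suc j) g)))
    ≡⟨ cong (λ e → g 0 (suc j) * (e * detℕ m (minorℕ 0 (minorℕ (suc j) g)))) (col 0 (s≤s z≤n)) ⟩
  g 0 (suc j) * (+ 0 * detℕ m (minorℕ 0 (minorℕ (suc j) g)))
    ≡⟨ cong (g 0 (suc j) *_) (ℤP.*-zeroˡ (detℕ m (minorℕ 0 (minorℕ (suc j) g)))) ⟩
  g 0 (suc j) * + 0
    ≡⟨ ℤP.*-zeroʳ (g 0 (suc j)) ⟩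
  + 0 ∎

detℕ-tridiagonal : ∀ m f → (∀ c → c ℕ.< m → f 0 (suc (suc c)) ≡ + 0) → (∀ r → r ℕ.< m → f (suc (suc r)) 0 ≡ + 0) →
  detℕ (suc (suc m)) f ≡
  f 0 0 * detℕ (suc m) (minorℕ 0 f) - f 0 1 * f 1 0 * detℕ m (minorℕ 0 (minorℕ 0 f))
detℕ-tridiagonal m f row0 col0 = begin
  detℕ (suc (suc m)) f
    ≡⟨ sumℤ-suc (suc m) _ ⟩
  T 0 + sumℤ (suc m) (λ j → T (suc j))
    ≡⟨ cong (_+_ (T 0)) (sumℤ-suc m _) ⟩
  T 0 + (T 1 + sumℤ m (λ j → T (suc (suc j))))
    ≡⟨ cong₂ (λ p q → T 0 + (sign 1 * (f 0 1 * p) + q))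
             (detℕ-first-column m (minorℕ 1 f) col0)
             (sumℤ-zero m (λ j j< → far-term j j<)) ⟩
  sign 0 * (f 0 0 * D1) + (sign 1 * (f 0 1 * (f 1 0 * D2)) + + 0)
    ≡⟨ ring (f 0 0) D1 (f 0 1) (f 1 0) D2 ⟩
  f 0 0 * D1 - f 0 1 * f 1 0 * D2 ∎
  where
  T : ℕ → ℤ
  T j = sign j * (f 0 j * detℕ (suc m) (minorℕ j f))
  D1 = detℕ (suc m) (minorℕ 0 f)
  D2 = detℕ m (minorℕ 0 (minorℕ 0 f))
  far-term : ∀ j → j ℕ.< m → T (suc (suc j)) ≡ + 0
  far-term j j< = begin
    sign j * (f 0 (suc (suc j)) * detℕ (suc m) (minorℕ (suc (suc j)) f))
      ≡⟨ cong (λ e → sign j * (e * detℕ (suc m) (minorℕ (suc (suc j)) f))) (row0 j j<) ⟩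
    sign j * (+ 0 * detℕ (suc m) (minorℕ (suc (suc j)) f))
      ≡⟨ cong (sign j *_) (ℤP.*-zeroˡ (detℕ (suc m) (minorℕ (suc (suc j)) f))) ⟩
    sign j * + 0
      ≡⟨ ℤP.*-zeroʳ (sign j) ⟩
    + 0 ∎
  ring : ∀ a p b c q → + 1 * (a * p) + (- + 1 * (b * (c * q)) + + 0) ≡ a * p - b * c * q
  ring = solve-∀

-- continuant a l s is the continuant K(a s, …, a (s + l ∸ 1)).
continuant : (ℕ → ℤ) → ℕ → ℕ → ℤ
continuant a zero s = + 1
continuant a (suc zero) s = a s
continuant a (suc (suc l)) s = a s * continuant a (suc l) (suc s) - continuant a l (suc (suc s))

-- The matrix of C_n^+

≡ᵇ-refl : ∀ a → (a ≡ᵇ a) ≡ true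
≡ᵇ-refl zero = refl
≡ᵇ-refl (suc a) = ≡ᵇ-refl a

≡ᵇ-≢ : ∀ a b → a ≢ b → (a ≡ᵇ b) ≡ false
≡ᵇ-≢ zero zero a≢b = ⊥-elim (a≢b refl)
≡ᵇ-≢ zero (suc b) _ = refl
≡ᵇ-≢ (suc a) zero _ = refl
≡ᵇ-≢ (suc a) (suc b) a≢b = ≡ᵇ-≢ a b (a≢b ∘ cong suc)

<ᵇ-< : ∀ a b → a ℕ.< b → (a ℕ.<ᵇ b) ≡ true
<ᵇ-< zero (suc b) _ = refl
<ᵇ-< (suc a) (suc b) (s≤s a<b) = <ᵇ-< a b a<b

<ᵇ-≥ : ∀ a b → b ℕ.≤ a → (a ℕ.<ᵇ b) ≡ false
<ᵇ-≥ a zero _ = refl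
<ᵇ-≥ (suc a) (suc b) (s≤s b≤a) = <ᵇ-≥ a b b≤a

<ᵇ⇒< : ∀ a b → (a ℕ.<ᵇ b) ≡ true → a ℕ.< b
<ᵇ⇒< zero (suc b) _ = s≤s z≤n
<ᵇ⇒< (suc a) (suc b) e = s≤s (<ᵇ⇒< a b e)

δ-refl : ∀ a → δ a a ≡ 1
δ-refl a rewrite ≡ᵇ-refl a = refl

δ-≢ : ∀ a b → a ≢ b → δ a b ≡ 0
δ-≢ a b a≢b rewrite ≡ᵇ-≢ a b a≢b = refl

sumℤ-δ : ∀ N c (x : ℕ → ℤ) → c ℕ.< N → sumℤ N (λ j → + δ j c * x j) ≡ x c
sumℤ-δ N c x c< =
  trans (sumℤ-single N c _ c< (λ k _ k≢c → cong (λ e → + e * x k) (δ-≢ k c k≢c)))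
        (trans (cong (λ e → + e * x c) (δ-refl c)) (ℤP.*-identityˡ (x c)))

indicator : Bool → ℤ
indicator true = + 1
indicator false = + 0

keepIf : Bool → ℕ → ℕ
keepIf true x = x
keepIf false x = 0

keepIf-0 : ∀ b → keepIf b 0 ≡ 0
keepIf-0 true = refl
keepIf-0 false = refl

sumℕ-+ : ∀ n (g h : ℕ → ℕ) → sumℕ n (λ k → g k ℕ.+ h k) ≡ sumℕ n g ℕ.+ sumℕ n h
sumℕ-+ zero g h = refl
sumℕ-+ (suc n) g h rewrite sumℕ-+ n g h = interchange (sumℕ n g) (sumℕ n h) (g n) (h n)
  where interchange : ∀ a b c d → a ℕ.+ b ℕ.+ (c ℕ.+ d) ≡ a ℕ.+ c ℕ.+ (b ℕ.+ d)
        interchange = ℕSolver.solve-∀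

sumℕ-δ : ∀ n i (g : ℕ → ℕ) → sumℕ n (λ k → δ i k ℕ.* g k) ≡ keepIf (i ℕ.<ᵇ n) (g i)
sumℕ-δ zero i g = refl
sumℕ-δ (suc n) i g rewrite sumℕ-δ n i g with ℕP.<-cmp i n
... | tri< i<n _ _ rewrite <ᵇ-< i n i<n | <ᵇ-< i (suc n) (ℕP.m<n⇒m<1+n i<n) | δ-≢ i n (ℕP.<⇒≢ i<n) =
  ℕP.+-identityʳ (g i)
... | tri≈ _ refl _ rewrite <ᵇ-≥ i i ℕP.≤-refl | <ᵇ-< i (suc i) (ℕP.n<1+n i) | δ-refl i =
  ℕP.+-identityʳ (g i)
... | tri> _ _ n<i rewrite <ᵇ-≥ i n (ℕP.<⇒≤ n<i) | <ᵇ-≥ i (suc n) n<i | δ-≢ i n (ℕP.<⇒≢ n<i ∘ sym) = refl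

adjCount-closed : ∀ n i j → adjCount n i j ≡
  keepIf (i ℕ.<ᵇ n) (δ j (nextC n i)) ℕ.+ keepIf (j ℕ.<ᵇ n) (δ i (nextC n j))
  ℕ.+ δ i 0 ℕ.* δ j n ℕ.+ δ j 0 ℕ.* δ i n
adjCount-closed n i j = cong (λ e → e ℕ.+ δ i 0 ℕ.* δ j n ℕ.+ δ j 0 ℕ.* δ i n)
  (trans (sumℕ-+ n (λ k → δ i k ℕ.* δ j (nextC n k)) (λ k → δ j k ℕ.* δ i (nextC n k)))
         (cong₂ ℕ._+_ (sumℕ-δ n i (λ k → δ j (nextC n k))) (sumℕ-δ n j (λ k → δ i (nextC n k)))))

adjCount-sym : ∀ n i j → adjCount n i j ≡ adjCount n j i
adjCount-sym n i j rewrite adjCount-closed n i j | adjCount-closed n j i =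
  swap-pairs (keepIf (i ℕ.<ᵇ n) (δ j (nextC n i))) (keepIf (j ℕ.<ᵇ n) (δ i (nextC n j)))
             (δ i 0 ℕ.* δ j n) (δ j 0 ℕ.* δ i n)
  where swap-pairs : ∀ a b c d → a ℕ.+ b ℕ.+ c ℕ.+ d ≡ b ℕ.+ a ℕ.+ d ℕ.+ c
        swap-pairs = ℕSolver.solve-∀

-- M-Cplus n (λ i → a (toℕ i)) i j is Mℕ n a (toℕ i) (toℕ j) by definition.
Mℕ : ℕ → (ℕ → ℤ) → Matℕ
Mℕ n a i j = (if i ≡ᵇ j then a i else + 0) - + adjCount n i j

Mℕ-sym : ∀ n a → Symmetricℕ (Mℕ n a)
Mℕ-sym n a i j with i ℕP.≟ j
... | yes refl = refl
... | no i≢j rewrite ≡ᵇ-≢ i j i≢j | ≡ᵇ-≢ j i (i≢j ∘ sym) = cong (λ e → + 0 - + e) (adjCount-sym n i j)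

prevC : ℕ → ℕ → ℕ
prevC n zero = n ∸ 1
prevC n (suc i) = i

nextC-prevC : ∀ n i → i ℕ.< n → nextC n (prevC n i) ≡ i
nextC-prevC (suc n) zero _ rewrite ≡ᵇ-refl n = refl
nextC-prevC n (suc i) i<n rewrite ≡ᵇ-≢ (suc i) n (ℕP.<⇒≢ i<n) = refl

prevC-nextC : ∀ n j → j ℕ.< n → prevC n (nextC n j) ≡ j
prevC-nextC n j j<n with suc j ℕP.≟ n
... | yes refl rewrite ≡ᵇ-refl (suc j) = refl
... | no j+1≢n rewrite ≡ᵇ-≢ (suc j) n j+1≢n = refl

prevC-< : ∀ n i → 0 ℕ.< n → i ℕ.< n → prevC n i ℕ.< n
prevC-< (suc n) zero _ _ = ℕP.n<1+n n
prevC-< n (suc i) _ i<n = ℕP.<-trans (ℕP.n<1+n i) i<n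

nextC-< : ∀ n i → i ℕ.< n → nextC n i ℕ.< n
nextC-< n i i<n with suc i ℕP.≟ n
... | yes refl rewrite ≡ᵇ-refl (suc i) = s≤s z≤n
... | no i+1≢n rewrite ≡ᵇ-≢ (suc i) n i+1≢n = ℕP.≤∧≢⇒< i<n i+1≢n

nextC-suc : ∀ n i → suc i ℕ.< n → nextC n i ≡ suc i
nextC-suc n i i+1<n rewrite ≡ᵇ-≢ (suc i) n (ℕP.<⇒≢ i+1<n) = refl

nextC-last : ∀ m → nextC (suc m) m ≡ 0
nextC-last m rewrite ≡ᵇ-refl m = refl

nextC-cases : ∀ n i → nextC n i ≡ suc i ⊎ nextC n i ≡ 0
nextC-cases n i with suc i ≡ᵇ n
... | true = inj₂ refl
... | false = inj₁ refl

nextC≢self : ∀ n i → 1 ℕ.≤ i → nextC n i ≢ i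
nextC≢self n i 1≤i with nextC-cases n i
... | inj₁ next≡i+1 = λ e → ℕP.1+n≢n (sym (trans (sym e) next≡i+1))
... | inj₂ next≡0 = λ e → ℕP.<⇒≢ 1≤i (trans (sym next≡0) e)

-- The i-th entry of M x for the matrix M of C_n^+, written out (see matVec-Mℕ).
Mrow : ℕ → (ℕ → ℤ) → (ℕ → ℤ) → ℕ → ℤ
Mrow n a x i = a i * x i
  - (indicator (i ℕ.<ᵇ n) * (x (nextC n i) + x (prevC n i)) + + δ i 0 * x n + + δ i n * x 0)

Mrow-diagonal-shift : ∀ n a b x i → Mrow n a x i ≡ Mrow n b x i + (a i - b i) * x i
Mrow-diagonal-shift n a b x i =
  ring (a i) (b i) (x i) (indicator (i ℕ.<ᵇ n) * (x (nextC n i) + x (prevC n i)) + + δ i 0 * x n + + δ i n * x 0)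
  where ring : ∀ p q r s → p * r - s ≡ q * r - s + (p - q) * r
        ring = solve-∀

sumℤ-keepIf-δ : ∀ N b c (x : ℕ → ℤ) → (b ≡ true → c ℕ.< N) →
  sumℤ N (λ j → + keepIf b (δ j c) * x j) ≡ indicator b * x c
sumℤ-keepIf-δ N false c x _ = trans (sumℤ-zero N (λ _ _ → refl)) (sym (ℤP.*-zeroˡ (x c)))
sumℤ-keepIf-δ N true c x c< = trans (sumℤ-δ N c x (c< refl)) (sym (ℤP.*-identityˡ (x c)))

-- Reindexes the cycle edges k → nextC n k by their head.
sumℤ-incoming : ∀ n i (x : ℕ → ℤ) → 0 ℕ.< n → i ℕ.< suc n →
  sumℤ (suc n) (λ j → + keepIf (j ℕ.<ᵇ n) (δ i (nextC n j)) * x j) ≡ indicator (i ℕ.<ᵇ n) * x (prevC n i)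
sumℤ-incoming n i x 0<n (s≤s i≤n) with ℕP.m≤n⇒m<n∨m≡n i≤n
... | inj₁ i<n rewrite <ᵇ-< i n i<n = begin
  sumℤ (suc n) (λ j → + keepIf (j ℕ.<ᵇ n) (δ i (nextC n j)) * x j)
    ≡⟨ sumℤ-single (suc n) (prevC n i) _ (ℕP.m<n⇒m<1+n p<n) others ⟩
  + keepIf (prevC n i ℕ.<ᵇ n) (δ i (nextC n (prevC n i))) * x (prevC n i)
    ≡⟨ cong₂ (λ b k → + keepIf b (δ i k) * x (prevC n i)) (<ᵇ-< (prevC n i) n p<n) (nextC-prevC n i i<n) ⟩
  + δ i i * x (prevC n i)
    ≡⟨ cong (λ e → + e * x (prevC n i)) (δ-refl i) ⟩
  + 1 * x (prevC n i) ∎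
  where
  p<n = prevC-< n i 0<n i<n
  others : ∀ k → k ℕ.< suc n → k ≢ prevC n i → + keepIf (k ℕ.<ᵇ n) (δ i (nextC n k)) * x k ≡ + 0
  others k (s≤s k≤n) k≢p with ℕP.m≤n⇒m<n∨m≡n k≤n
  ... | inj₁ k<n rewrite <ᵇ-< k n k<n
    | δ-≢ i (nextC n k) (λ i≡next → k≢p (trans (sym (prevC-nextC n k k<n)) (cong (prevC n) (sym i≡next)))) = refl
  ... | inj₂ refl rewrite <ᵇ-≥ k k ℕP.≤-refl = refl
... | inj₂ refl rewrite <ᵇ-≥ i i ℕP.≤-refl =
  trans (sumℤ-zero (suc i) none) (sym (ℤP.*-zeroˡ (x (prevC i i))))
  where
  none : ∀ k → k ℕ.< suc i → + keepIf (k ℕ.<ᵇ i) (δ i (nextC i k)) * x k ≡ + 0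
  none k (s≤s k≤i) with ℕP.m≤n⇒m<n∨m≡n k≤i
  ... | inj₁ k<i rewrite <ᵇ-< k i k<i | δ-≢ i (nextC i k) (λ e → ℕP.<-irrefl (sym e) (nextC-< i k k<i)) = refl
  ... | inj₂ refl rewrite <ᵇ-≥ k k ℕP.≤-refl = refl

sumℤ-scaled-δ : ∀ N p c (x : ℕ → ℤ) → c ℕ.< N → sumℤ N (λ j → + (p ℕ.* δ j c) * x j) ≡ + p * x c
sumℤ-scaled-δ N p c x c< = begin
  sumℤ N (λ j → + (p ℕ.* δ j c) * x j)
    ≡⟨ sumℤ-cong N (λ j _ → trans (cong (_* x j) (ℤP.pos-* p (δ j c))) (ℤP.*-assoc (+ p) (+ δ j c) (x j))) ⟩
  sumℤ N (λ j → + p * (+ δ j c * x j))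
    ≡⟨ sym (sumℤ-*ˡ N (+ p) _) ⟩
  + p * sumℤ N (λ j → + δ j c * x j)
    ≡⟨ cong (+ p *_) (sumℤ-δ N c x c<) ⟩
  + p * x c ∎

pos-+₄ : ∀ a b c d → + (a ℕ.+ b ℕ.+ c ℕ.+ d) ≡ + a + + b + + c + + d
pos-+₄ a b c d rewrite ℤP.pos-+ (a ℕ.+ b ℕ.+ c) d | ℤP.pos-+ (a ℕ.+ b) c | ℤP.pos-+ a b = refl

adjCount-split : ∀ n i j (x : ℕ → ℤ) → + adjCount n i j * x j ≡
  + keepIf (i ℕ.<ᵇ n) (δ j (nextC n i)) * x j + + keepIf (j ℕ.<ᵇ n) (δ i (nextC n j)) * x j
  + + (δ i 0 ℕ.* δ j n) * x j + + (δ i n ℕ.* δ j 0) * x j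
adjCount-split n i j x = begin
  + adjCount n i j * x j
    ≡⟨ cong (λ k → + k * x j) (trans (adjCount-closed n i j)
         (cong (λ e → A₁ ℕ.+ A₂ ℕ.+ δ i 0 ℕ.* δ j n ℕ.+ e) (ℕP.*-comm (δ j 0) (δ i n)))) ⟩
  + (A₁ ℕ.+ A₂ ℕ.+ δ i 0 ℕ.* δ j n ℕ.+ δ i n ℕ.* δ j 0) * x j
    ≡⟨ cong (_* x j) (pos-+₄ A₁ A₂ (δ i 0 ℕ.* δ j n) (δ i n ℕ.* δ j 0)) ⟩
  (+ A₁ + + A₂ + + (δ i 0 ℕ.* δ j n) + + (δ i n ℕ.* δ j 0)) * x j
    ≡⟨ distrib (+ A₁) (+ A₂) (+ (δ i 0 ℕ.* δ j n)) (+ (δ i n ℕ.* δ j 0)) (x j) ⟩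
  + A₁ * x j + + A₂ * x j + + (δ i 0 ℕ.* δ j n) * x j + + (δ i n ℕ.* δ j 0) * x j ∎
  where
  A₁ = keepIf (i ℕ.<ᵇ n) (δ j (nextC n i))
  A₂ = keepIf (j ℕ.<ᵇ n) (δ i (nextC n j))
  distrib : ∀ a b c d y → (a + b + c + d) * y ≡ a * y + b * y + c * y + d * y
  distrib = solve-∀

sumℤ-adjacency : ∀ n i (x : ℕ → ℤ) → 0 ℕ.< n → i ℕ.< suc n →
  sumℤ (suc n) (λ j → + adjCount n i j * x j) ≡
  indicator (i ℕ.<ᵇ n) * (x (nextC n i) + x (prevC n i)) + + δ i 0 * x n + + δ i n * x 0
sumℤ-adjacency n i x 0<n i< = begin
  sumℤ (suc n) (λ j → + adjCount n i j * x j)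
    ≡⟨ sumℤ-cong (suc n) (λ j _ → adjCount-split n i j x) ⟩
  sumℤ (suc n) (λ j → A₁ j + A₂ j + A₃ j + A₄ j)
    ≡⟨ sumℤ-+ (suc n) _ _ ⟩
  sumℤ (suc n) (λ j → A₁ j + A₂ j + A₃ j) + Σ A₄
    ≡⟨ cong (_+ Σ A₄) (sumℤ-+ (suc n) _ _) ⟩
  sumℤ (suc n) (λ j → A₁ j + A₂ j) + Σ A₃ + Σ A₄
    ≡⟨ cong (λ e → e + Σ A₃ + Σ A₄) (sumℤ-+ (suc n) A₁ A₂) ⟩
  Σ A₁ + Σ A₂ + Σ A₃ + Σ A₄
    ≡⟨ cong₂ (λ p q → p + q + Σ A₄) (cong₂ _+_ next-edge prev-edge)
             (sumℤ-scaled-δ (suc n) (δ i 0) n x (ℕP.n<1+n n)) ⟩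
  ι * x (nextC n i) + ι * x (prevC n i) + + δ i 0 * x n + Σ A₄
    ≡⟨ cong₂ (λ p q → p + + δ i 0 * x n + q) (sym (ℤP.*-distribˡ-+ ι _ _))
             (sumℤ-scaled-δ (suc n) (δ i n) 0 x (s≤s z≤n)) ⟩
  ι * (x (nextC n i) + x (prevC n i)) + + δ i 0 * x n + + δ i n * x 0 ∎
  where
  ι = indicator (i ℕ.<ᵇ n)
  Σ = sumℤ (suc n)
  A₁ A₂ A₃ A₄ : ℕ → ℤ
  A₁ j = + keepIf (i ℕ.<ᵇ n) (δ j (nextC n i)) * x j
  A₂ j = + keepIf (j ℕ.<ᵇ n) (δ i (nextC n j)) * x j
  A₃ j = + (δ i 0 ℕ.* δ j n) * x j
  A₄ j = + (δ i n ℕ.* δ j 0) * x j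
  next-edge : Σ A₁ ≡ ι * x (nextC n i)
  next-edge = sumℤ-keepIf-δ (suc n) (i ℕ.<ᵇ n) (nextC n i) x
    (λ i<ᵇn → ℕP.m<n⇒m<1+n (nextC-< n i (<ᵇ⇒< i n i<ᵇn)))
  prev-edge : Σ A₂ ≡ ι * x (prevC n i)
  prev-edge = sumℤ-incoming n i x 0<n i<

matVec-Mℕ : ∀ n a x i → 0 ℕ.< n → i ℕ.< suc n → matVec (suc n) (Mℕ n a) x i ≡ Mrow n a x i
matVec-Mℕ n a x i 0<n i< = begin
  sumℤ (suc n) (λ j → ((if i ≡ᵇ j then a i else + 0) - + adjCount n i j) * x j)
    ≡⟨ sumℤ-cong (suc n) (λ j _ → distrib-sub (if i ≡ᵇ j then a i else + 0) (+ adjCount n i j) (x j)) ⟩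
  sumℤ (suc n) (λ j → (if i ≡ᵇ j then a i else + 0) * x j - + adjCount n i j * x j)
    ≡⟨ sumℤ-- (suc n) _ _ ⟩
  sumℤ (suc n) (λ j → (if i ≡ᵇ j then a i else + 0) * x j) - sumℤ (suc n) (λ j → + adjCount n i j * x j)
    ≡⟨ cong₂ _-_ diagonal (sumℤ-adjacency n i x 0<n i<) ⟩
  Mrow n a x i ∎
  where
  distrib-sub : ∀ p q y → (p - q) * y ≡ p * y - q * y
  distrib-sub = solve-∀
  diagonal : sumℤ (suc n) (λ j → (if i ≡ᵇ j then a i else + 0) * x j) ≡ a i * x i
  diagonal = trans (sumℤ-single (suc n) i _ i<
                     (λ k _ k≢i → cong (λ b → (if b then a i else + 0) * x k) (≡ᵇ-≢ i k (k≢i ∘ sym))))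
                   (cong (λ b → (if b then a i else + 0) * x i) (≡ᵇ-refl i))

Mrow-0 : ∀ m a x → Mrow (suc (suc m)) a x 0 ≡ a 0 * x 0 - x 1 - x (suc m) - x (suc (suc m))
Mrow-0 m a x = ring (a 0) (x 0) (x 1) (x (suc m)) (x (suc (suc m)))
  where ring : ∀ p q r s t → p * q - (+ 1 * (r + s) + + 1 * t + + 0 * q) ≡ p * q - r - s - t
        ring = solve-∀

Mrow-inner : ∀ m a x k → suc (suc k) ℕ.< suc (suc m) →
  Mrow (suc (suc m)) a x (suc k) ≡ a (suc k) * x (suc k) - x (suc (suc k)) - x k
Mrow-inner m a x k k+2<n rewrite <ᵇ-< (suc k) (suc (suc m)) (ℕP.<-trans (ℕP.n<1+n (suc k)) k+2<n)
  | nextC-suc (suc (suc m)) (suc k) k+2<n | δ-≢ (suc k) (suc (suc m)) (ℕP.<⇒≢ (ℕP.<-trans (ℕP.n<1+n (suc k)) k+2<n)) =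
  ring (a (suc k)) (x (suc k)) (x (suc (suc k))) (x k) (x (suc (suc m))) (x 0)
  where ring : ∀ p q r s t u → p * q - (+ 1 * (r + s) + + 0 * t + + 0 * u) ≡ p * q - r - s
        ring = solve-∀

Mrow-last : ∀ m a x → Mrow (suc (suc m)) a x (suc m) ≡ a (suc m) * x (suc m) - x 0 - x m
Mrow-last m a x rewrite <ᵇ-< (suc m) (suc (suc m)) (ℕP.n<1+n (suc m)) | nextC-last (suc m)
  | δ-≢ (suc m) (suc (suc m)) (ℕP.<⇒≢ (ℕP.n<1+n (suc m))) =
  ring (a (suc m)) (x (suc m)) (x 0) (x m) (x (suc (suc m)))
  where ring : ∀ p q r s t → p * q - (+ 1 * (r + s) + + 0 * t + + 0 * r) ≡ p * q - r - s
        ring = solve-∀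

Mrow-pendant : ∀ m a x → Mrow (suc (suc m)) a x (suc (suc m)) ≡ a (suc (suc m)) * x (suc (suc m)) - x 0
Mrow-pendant m a x rewrite <ᵇ-≥ (suc (suc m)) (suc (suc m)) ℕP.≤-refl | δ-refl (suc (suc m)) =
  ring (a (suc (suc m))) (x (suc (suc m))) (x (nextC (suc (suc m)) (suc (suc m))) + x (prevC (suc (suc m)) (suc (suc m)))) (x 0)
  where ring : ∀ p q r u → p * q - (+ 0 * r + + 0 * q + + 1 * u) ≡ p * q - u
        ring = solve-∀

Mrow-by-cases : ∀ m a x (P : ℕ → ℤ) →
  a 0 * x 0 - x 1 - x (suc m) - x (suc (suc m)) ≡ P 0 →
  (∀ k → suc (suc k) ℕ.< suc (suc m) → a (suc k) * x (suc k) - x (suc (suc k)) - x k ≡ P (suc k)) →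
  a (suc m) * x (suc m) - x 0 - x m ≡ P (suc m) →
  a (suc (suc m)) * x (suc (suc m)) - x 0 ≡ P (suc (suc m)) →
  ∀ i → i ℕ.< suc (suc (suc m)) → Mrow (suc (suc m)) a x i ≡ P i
Mrow-by-cases m a x P row-0 inner last pendant zero _ = trans (Mrow-0 m a x) row-0
Mrow-by-cases m a x P row-0 inner last pendant (suc k) (s≤s k<m+2) with ℕP.<-cmp (suc (suc k)) (suc (suc m))
... | tri< k+2<n _ _ = trans (Mrow-inner m a x k k+2<n) (inner k k+2<n)
... | tri≈ _ k+2≡n _ rewrite ℕP.suc-injective (ℕP.suc-injective k+2≡n) = trans (Mrow-last m a x) last
... | tri> _ _ n<k+2 with ℕP.m≤n⇒m<n∨m≡n k<m+2
...   | inj₁ k<m+1 = ⊥-elim (ℕP.<-irrefl refl (ℕP.≤-trans (ℕP.≤-pred (ℕP.≤-pred n<k+2)) (ℕP.≤-pred (ℕP.≤-pred k<m+1))))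
...   | inj₂ refl = trans (Mrow-pendant m a x) pendant

unitℕ : ℕ → ℕ → ℤ
unitℕ j k = + δ k j

Mℕ-entry : ∀ n a i j → 0 ℕ.< n → i ℕ.< suc n → j ℕ.< suc n → Mℕ n a i j ≡ Mrow n a (unitℕ j) i
Mℕ-entry n a i j 0<n i< j< = begin
  Mℕ n a i j
    ≡⟨ sym (ℤP.*-identityʳ _) ⟩
  Mℕ n a i j * + 1
    ≡⟨ cong (λ e → Mℕ n a i j * + e) (sym (δ-refl j)) ⟩
  Mℕ n a i j * unitℕ j j
    ≡⟨ sym (sumℤ-single (suc n) j _ j< (λ k _ k≢j →
         trans (cong (λ e → Mℕ n a i k * + e) (δ-≢ k j k≢j)) (ℤP.*-zeroʳ (Mℕ n a i k)))) ⟩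
  matVec (suc n) (Mℕ n a) (unitℕ j) i
    ≡⟨ matVec-Mℕ n a (unitℕ j) i 0<n i< ⟩
  Mrow n a (unitℕ j) i ∎

Mℕ-cycle-row : ∀ n a k j → suc k ℕ.< n → j ℕ.< suc n →
  Mℕ n a (suc k) j ≡ a (suc k) * + δ (suc k) j - (+ δ (nextC n (suc k)) j + + δ k j)
Mℕ-cycle-row n a k j k+1<n j< rewrite Mℕ-entry n a (suc k) j (ℕP.≤-trans (s≤s z≤n) k+1<n) (ℕP.m<n⇒m<1+n k+1<n) j<
  | <ᵇ-< (suc k) n k+1<n | δ-≢ (suc k) n (ℕP.<⇒≢ k+1<n) =
  ring (a (suc k)) (+ δ (suc k) j) (+ δ (nextC n (suc k)) j) (+ δ k j) (+ δ n j) (+ δ 0 j)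
  where ring : ∀ p q r s t u → p * q - (+ 1 * (r + s) + + 0 * t + + 0 * u) ≡ p * q - (r + s)
        ring = solve-∀

adjCount-loopless : ∀ n i → 1 ℕ.≤ i → adjCount n i i ≡ 0
adjCount-loopless n i 1≤i rewrite adjCount-closed n i i | δ-≢ i 0 (ℕP.<⇒≢ 1≤i ∘ sym)
  | δ-≢ i (nextC n i) (nextC≢self n i 1≤i ∘ sym) | keepIf-0 (i ℕ.<ᵇ n) = refl

Mℕ-diagonal : ∀ n a i → 1 ℕ.≤ i → Mℕ n a i i ≡ a i
Mℕ-diagonal n a i 1≤i rewrite ≡ᵇ-refl i | adjCount-loopless n i 1≤i = ℤP.+-identityʳ (a i)

Mℕ-path : ∀ n a k → suc (suc k) ℕ.< n → Mℕ n a (suc k) (suc (suc k)) ≡ - + 1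
Mℕ-path n a k k+2<n =
  trans (Mℕ-cycle-row n a k (suc (suc k)) (ℕP.<-trans (ℕP.n<1+n _) k+2<n) (ℕP.m<n⇒m<1+n k+2<n))
        (edge (a (suc k)) (δ-≢ (suc k) (suc (suc k)) (ℕP.1+n≢n ∘ sym))
              (trans (cong (λ v → δ v (suc (suc k))) (nextC-suc n (suc k) k+2<n)) (δ-refl (suc (suc k))))
              (δ-≢ k (suc (suc k)) (ℕP.<⇒≢ (ℕP.<-trans (ℕP.n<1+n k) (ℕP.n<1+n (suc k))))))
  where edge : ∀ p {q r s} → q ≡ 0 → r ≡ 1 → s ≡ 0 → p * + q - (+ r + + s) ≡ - + 1
        edge p refl refl refl = ring p
          where ring : ∀ p → p * + 0 - (+ 1 + + 0) ≡ - + 1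
                ring = solve-∀

no-edge : ∀ p {q r s} → q ≡ 0 → r ≡ 0 → s ≡ 0 → p * + q - (+ r + + s) ≡ + 0
no-edge p refl refl refl = ring p
  where ring : ∀ p → p * + 0 - (+ 0 + + 0) ≡ + 0
        ring = solve-∀

Mℕ-far : ∀ n a k j → suc k ℕ.< n → suc (suc (suc k)) ℕ.≤ j → j ℕ.< suc n → Mℕ n a (suc k) j ≡ + 0
Mℕ-far n a k j k+1<n k+3≤j j< =
  trans (Mℕ-cycle-row n a k j k+1<n j<)
        (no-edge (a (suc k)) (δ-≢ (suc k) j (ℕP.<⇒≢ (ℕP.<-trans (ℕP.n<1+n (suc k)) k+3≤j)))
                 (δ-≢ (nextC n (suc k)) j next≢j)
                 (δ-≢ k j (ℕP.<⇒≢ (ℕP.<-trans (ℕP.<-trans (ℕP.n<1+n k) (ℕP.n<1+n (suc k))) k+3≤j))))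
  where
  next≢j : nextC n (suc k) ≢ j
  next≢j with nextC-cases n (suc k)
  ... | inj₁ next≡k+2 = λ e → ℕP.<⇒≢ k+3≤j (trans (sym next≡k+2) e)
  ... | inj₂ next≡0 = λ e → ℕP.<⇒≢ (ℕP.≤-trans (s≤s z≤n) k+3≤j) (trans (sym next≡0) e)

Mℕ-last-pendant : ∀ m a → Mℕ (suc (suc m)) a (suc m) (suc (suc m)) ≡ + 0
Mℕ-last-pendant m a =
  trans (Mℕ-cycle-row (suc (suc m)) a m (suc (suc m)) (ℕP.n<1+n (suc m)) (ℕP.n<1+n _))
        (no-edge (a (suc m)) (δ-≢ (suc m) (suc (suc m)) (ℕP.1+n≢n ∘ sym))
                 (cong (λ v → δ v (suc (suc m))) (nextC-last (suc m)))
                 (δ-≢ m (suc (suc m)) (ℕP.<⇒≢ (ℕP.<-trans (ℕP.n<1+n m) (ℕP.n<1+n (suc m))))))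

-- The principal submatrix of Mℕ (m + 2) a on the vertices s + 1, …, m + 2.
tailℕ : ℕ → (ℕ → ℤ) → ℕ → Matℕ
tailℕ m a s r c = Mℕ (suc (suc m)) a (suc (s ℕ.+ r)) (suc (s ℕ.+ c))

minorℕ-tailℕ : ∀ m a s r c → minorℕ 0 (tailℕ m a s) r c ≡ tailℕ m a (suc s) r c
minorℕ-tailℕ m a s r c =
  cong₂ (λ u v → Mℕ (suc (suc m)) a (suc u) (suc v)) (ℕP.+-suc s r) (ℕP.+-suc s c)

tailℕ-diagonal : ∀ m a s → tailℕ m a s 0 0 ≡ a (suc s)
tailℕ-diagonal m a s =
  trans (cong (λ v → Mℕ (suc (suc m)) a (suc v) (suc v)) (ℕP.+-identityʳ s)) (Mℕ-diagonal (suc (suc m)) a (suc s) (s≤s z≤n))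

tailℕ-path : ∀ m a s → s ℕ.< m → tailℕ m a s 0 1 ≡ - + 1
tailℕ-path m a s s<m = trans (cong₂ (λ u v → Mℕ (suc (suc m)) a (suc u) (suc v)) (ℕP.+-identityʳ s) (ℕP.+-comm s 1))
  (Mℕ-path (suc (suc m)) a s (s≤s (s≤s s<m)))

tailℕ-path′ : ∀ m a s → s ℕ.< m → tailℕ m a s 1 0 ≡ - + 1
tailℕ-path′ m a s s<m = trans (Mℕ-sym (suc (suc m)) a (suc (s ℕ.+ 1)) (suc (s ℕ.+ 0))) (tailℕ-path m a s s<m)

tailℕ-far : ∀ m a s c → suc (s ℕ.+ c) ℕ.≤ m → tailℕ m a s 0 (suc (suc c)) ≡ + 0
tailℕ-far m a s c s+c<m = trans (cong (λ v → Mℕ (suc (suc m)) a (suc v) (suc (s ℕ.+ suc (suc c)))) (ℕP.+-identityʳ s))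
  (Mℕ-far (suc (suc m)) a s (suc (s ℕ.+ suc (suc c))) (s≤s (s≤s (ℕP.≤-trans (ℕP.m≤m+n s c) (ℕP.<⇒≤ s+c<m))))
    (ℕP.≤-trans (s≤s (s≤s (s≤s (ℕP.m≤m+n s c)))) (s≤s (ℕP.≤-reflexive (sym s+c+2≡))))
    (s≤s (s≤s (ℕP.≤-trans (ℕP.≤-reflexive s+c+2≡) (s≤s s+c<m)))))
  where s+c+2≡ = trans (ℕP.+-suc s (suc c)) (cong suc (ℕP.+-suc s c))

tailℕ-far′ : ∀ m a s r → suc (s ℕ.+ r) ℕ.≤ m → tailℕ m a s (suc (suc r)) 0 ≡ + 0
tailℕ-far′ m a s r s+r<m = trans (Mℕ-sym (suc (suc m)) a (suc (s ℕ.+ suc (suc r))) (suc (s ℕ.+ 0))) (tailℕ-far m a s r s+r<m)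

tailℕ-last-pendant : ∀ m a → tailℕ m a m 0 1 ≡ + 0
tailℕ-last-pendant m a =
  trans (cong₂ (λ u v → Mℕ (suc (suc m)) a (suc u) (suc v)) (ℕP.+-identityʳ m) (ℕP.+-comm m 1)) (Mℕ-last-pendant m a)

-- The vertices 1, …, m + 1 form a path and m + 2 is isolated from it.
detℕ-tailℕ : ∀ m a l s → l ℕ.+ s ≡ suc m →
  detℕ (suc l) (tailℕ m a s) ≡ a (suc (suc m)) * continuant a l (suc s)
detℕ-tailℕ m a zero s refl =
  trans (detℕ-first-column 0 (tailℕ m a (suc m)) (λ _ ())) (cong (_* + 1) (tailℕ-diagonal m a (suc m)))
detℕ-tailℕ m a (suc zero) s refl = begin
  detℕ 2 t
    ≡⟨ detℕ-tridiagonal 0 t (λ _ ()) (λ _ ()) ⟩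
  t 0 0 * detℕ 1 (minorℕ 0 t) - t 0 1 * t 1 0 * + 1
    ≡⟨ cong₂ (λ p q → p * detℕ 1 (minorℕ 0 t) - q * t 1 0 * + 1) (tailℕ-diagonal m a m) (tailℕ-last-pendant m a) ⟩
  a (suc m) * detℕ 1 (minorℕ 0 t) - + 0 * t 1 0 * + 1
    ≡⟨ cong (λ d → a (suc m) * d - + 0 * t 1 0 * + 1)
            (trans (detℕ-cong 1 (λ r c _ _ → minorℕ-tailℕ m a m r c)) (detℕ-tailℕ m a 0 (suc m) refl)) ⟩
  a (suc m) * (a (suc (suc m)) * + 1) - + 0 * t 1 0 * + 1
    ≡⟨ ring (a (suc m)) (a (suc (suc m))) (t 1 0) ⟩
  a (suc (suc m)) * a (suc m) ∎
  where
  t = tailℕ m a m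
  ring : ∀ p q r → p * (q * + 1) - + 0 * r * + 1 ≡ q * p
  ring = solve-∀
detℕ-tailℕ .(suc (l ℕ.+ s)) a (suc (suc l)) s refl = begin
  detℕ (suc (suc (suc l))) t
    ≡⟨ detℕ-tridiagonal (suc l) t (λ c c≤l → tailℕ-far m a s c (bound c c≤l))
                                  (λ r r≤l → tailℕ-far′ m a s r (bound r r≤l)) ⟩
  t 0 0 * detℕ (suc (suc l)) (minorℕ 0 t) - t 0 1 * t 1 0 * detℕ (suc l) (minorℕ 0 (minorℕ 0 t))
    ≡⟨ cong₂ (λ p q → t 0 0 * p - t 0 1 * t 1 0 * q)
         (trans (detℕ-cong (suc (suc l)) (λ r c _ _ → minorℕ-tailℕ m a s r c))
                (detℕ-tailℕ m a (suc l) (suc s) (ℕP.+-suc (suc l) s)))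
         (trans (detℕ-cong (suc l) (λ r c _ _ → trans (minorℕ-tailℕ m a s (suc r) (suc c)) (minorℕ-tailℕ m a (suc s) r c)))
                (detℕ-tailℕ m a l (suc (suc s)) (trans (ℕP.+-suc l (suc s)) (cong suc (ℕP.+-suc l s))))) ⟩
  t 0 0 * (a n * K₁) - t 0 1 * t 1 0 * (a n * K₂)
    ≡⟨ cong₂ (λ p q → p * (a n * K₁) - q * (a n * K₂)) (tailℕ-diagonal m a s)
             (cong₂ _*_ (tailℕ-path m a s s<m) (tailℕ-path′ m a s s<m)) ⟩
  a (suc s) * (a n * K₁) - - + 1 * - + 1 * (a n * K₂)
    ≡⟨ ring (a (suc s)) (a n) K₁ K₂ ⟩
  a n * (a (suc s) * K₁ - K₂) ∎
  where
  m = suc (l ℕ.+ s)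
  n = suc (suc m)
  t = tailℕ m a s
  K₁ = continuant a (suc l) (suc (suc s))
  K₂ = continuant a l (suc (suc (suc s)))
  s<m : s ℕ.< m
  s<m = s≤s (ℕP.m≤n+m s l)
  bound : ∀ c → c ℕ.< suc l → suc (s ℕ.+ c) ℕ.≤ m
  bound c c<l+1 = s≤s (ℕP.≤-trans (ℕP.≤-reflexive (ℕP.+-comm s c)) (ℕP.+-monoˡ-≤ s (ℕP.≤-pred c<l+1)))
  ring : ∀ p q k₁ k₂ → p * (q * k₁) - - + 1 * - + 1 * (q * k₂) ≡ q * (p * k₁ - k₂)
  ring = solve-∀

detℕ-minor00-Mℕ : ∀ m a →
  detℕ (suc (suc m)) (minorℕ 0 (Mℕ (suc (suc m)) a)) ≡ a (suc (suc m)) * continuant a (suc m) 1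
detℕ-minor00-Mℕ m a = detℕ-tailℕ m a (suc m) 0 (cong suc (ℕP.+-identityʳ m))

-- Positivity

-- Y k is c X k / z k with the common denominator c = ∏ z.
opaque
  clear-denominators : ∀ N (z X : ℕ → ℤ) → (∀ k → k ℕ.< N → z k ≢ + 0) →
    ∃ λ (c : ℤ) → ∃ λ (Y : ℕ → ℤ) → c ≢ + 0 × (∀ k → k ℕ.< N → c * X k ≡ z k * Y k)
  clear-denominators zero z X _ = + 1 , (λ _ → + 0) , (λ ()) , (λ k ())
  clear-denominators (suc N) z X z≢0
    with clear-denominators N z X (λ k k< → z≢0 k (ℕP.m<n⇒m<1+n k<))
  ... | c , Y , c≢0 , cX≡zY = c * z N , Y′ , i*j≢0 c (z N) c≢0 (z≢0 N (ℕP.n<1+n N)) , cX≡zY′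
    where
    Y′ : ℕ → ℤ
    Y′ k = if k ℕ.<ᵇ N then Y k * z N else c * X N
    cX≡zY′ : ∀ k → k ℕ.< suc N → c * z N * X k ≡ z k * Y′ k
    cX≡zY′ k (s≤s k≤N) with ℕP.m≤n⇒m<n∨m≡n k≤N
    ... | inj₁ k<N rewrite <ᵇ-< k N k<N = begin
      c * z N * X k    ≡⟨ ring₁ c (z N) (X k) ⟩
      c * X k * z N    ≡⟨ cong (_* z N) (cX≡zY k k<N) ⟩
      z k * Y k * z N  ≡⟨ ℤP.*-assoc (z k) (Y k) (z N) ⟩
      z k * (Y k * z N) ∎
      where ring₁ : ∀ p q r → p * q * r ≡ p * r * q
            ring₁ = solve-∀
    ... | inj₂ refl rewrite <ᵇ-≥ k k ℕP.≤-refl = ring₂ c (z k) (X k)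
      where ring₂ : ∀ p q r → p * q * r ≡ q * (p * r)
            ring₂ = solve-∀

quadℕ : ℕ → (ℕ → ℤ) → (ℕ → ℤ) → ℤ
quadℕ n a X = sumℤ (suc n) (λ i → X i * matVec (suc n) (Mℕ n a) X i)

quadℕ-cong : ∀ n a X X′ → (∀ k → k ℕ.< suc n → X k ≡ X′ k) → quadℕ n a X ≡ quadℕ n a X′
quadℕ-cong n a X X′ X≗X′ = sumℤ-cong (suc n) (λ i i< →
  cong₂ _*_ (X≗X′ i i<) (sumℤ-cong (suc n) (λ j j< → cong (Mℕ n a i j *_) (X≗X′ j j<))))

quadℕ-scale : ∀ n a c X → quadℕ n a (λ k → c * X k) ≡ c * c * quadℕ n a X
quadℕ-scale n a c X = begin
  sumℤ (suc n) (λ i → c * X i * sumℤ (suc n) (λ j → Mℕ n a i j * (c * X j)))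
    ≡⟨ sumℤ-cong (suc n) (λ i _ → cong (c * X i *_)
         (trans (sumℤ-cong (suc n) (λ j _ → *-left-comm (Mℕ n a i j) c (X j))) (sym (sumℤ-*ˡ (suc n) c _)))) ⟩
  sumℤ (suc n) (λ i → c * X i * (c * matVec (suc n) (Mℕ n a) X i))
    ≡⟨ sumℤ-cong (suc n) (λ i _ → regroup c (X i) (matVec (suc n) (Mℕ n a) X i)) ⟩
  sumℤ (suc n) (λ i → c * c * (X i * matVec (suc n) (Mℕ n a) X i))
    ≡⟨ sym (sumℤ-*ˡ (suc n) (c * c) _) ⟩
  c * c * quadℕ n a X ∎
  where
  *-left-comm : ∀ p q r → p * (q * r) ≡ q * (p * r)
  *-left-comm = solve-∀
  regroup : ∀ p q r → p * q * (p * r) ≡ p * p * (q * r)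
  regroup = solve-∀

sumℤ-cycle-reindex : ∀ n′ (g : ℕ → ℕ → ℤ) →
  sumℤ (suc n′) (λ i → g (prevC (suc n′) i) i) ≡ sumℤ (suc n′) (λ i → g i (nextC (suc n′) i))
sumℤ-cycle-reindex n′ g = begin
  sumℤ (suc n′) (λ i → g (prevC (suc n′) i) i)
    ≡⟨ sumℤ-suc n′ _ ⟩
  g n′ 0 + sumℤ n′ (λ i → g i (suc i))
    ≡⟨ ℤP.+-comm (g n′ 0) _ ⟩
  sumℤ n′ (λ i → g i (suc i)) + g n′ 0
    ≡⟨ cong₂ _+_ (sumℤ-cong n′ (λ i i< → cong (g i) (sym (nextC-suc (suc n′) i (s≤s i<)))))
                 (cong (g n′) (sym (nextC-last n′))) ⟩
  sumℤ n′ (λ i → g i (nextC (suc n′) i)) + g n′ (nextC (suc n′) n′)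
    ≡⟨ sym (sumℤ-last n′ _) ⟩
  sumℤ (suc n′) (λ i → g i (nextC (suc n′) i)) ∎

sumℤ-indicator : ∀ n (G : ℕ → ℤ) → sumℤ (suc n) (λ i → indicator (i ℕ.<ᵇ n) * G i) ≡ sumℤ n G
sumℤ-indicator n G = begin
  sumℤ (suc n) (λ i → indicator (i ℕ.<ᵇ n) * G i)
    ≡⟨ sumℤ-last n _ ⟩
  sumℤ n (λ i → indicator (i ℕ.<ᵇ n) * G i) + indicator (n ℕ.<ᵇ n) * G n
    ≡⟨ cong₂ _+_ (sumℤ-cong n (λ i i< → trans (cong (λ b → indicator b * G i) (<ᵇ-< i n i<)) (ℤP.*-identityˡ (G i))))
                 (cong (λ b → indicator b * G n) (<ᵇ-≥ n n ℕP.≤-refl)) ⟩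
  sumℤ n G + + 0
    ≡⟨ ℤP.+-identityʳ _ ⟩
  sumℤ n G ∎

-- Each cycle edge {k, k⁺} is seen once from k and once from k⁺.
sumℤ-cycle-neighbours : ∀ n′ (P : ℕ → ℕ → ℤ) →
  sumℤ (suc (suc n′)) (λ i → indicator (i ℕ.<ᵇ suc n′) * (P i (nextC (suc n′) i) + P i (prevC (suc n′) i))) ≡
  sumℤ (suc n′) (λ k → P k (nextC (suc n′) k) + P (nextC (suc n′) k) k)
sumℤ-cycle-neighbours n′ P = begin
  sumℤ (suc n) (λ i → indicator (i ℕ.<ᵇ n) * (P i (nextC n i) + P i (prevC n i)))
    ≡⟨ sumℤ-indicator n _ ⟩
  sumℤ n (λ i → P i (nextC n i) + P i (prevC n i))
    ≡⟨ sumℤ-+ n _ _ ⟩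
  sumℤ n (λ i → P i (nextC n i)) + sumℤ n (λ i → P i (prevC n i))
    ≡⟨ cong (_+_ (sumℤ n (λ i → P i (nextC n i)))) (sumℤ-cycle-reindex n′ (λ p i → P i p)) ⟩
  sumℤ n (λ i → P i (nextC n i)) + sumℤ n (λ i → P (nextC n i) i)
    ≡⟨ sym (sumℤ-+ n _ _) ⟩
  sumℤ n (λ k → P k (nextC n k) + P (nextC n k) k) ∎
  where n = suc n′

edgeEnergy : ℕ → (ℕ → ℤ) → (ℕ → ℤ) → ℤ
edgeEnergy n z Y = sumℤ n (λ k → z k * z (nextC n k) * ((Y k - Y (nextC n k)) * (Y k - Y (nextC n k))))
  + z 0 * z n * ((Y 0 - Y n) * (Y 0 - Y n))

potential : ℕ → (ℕ → ℤ) → (ℕ → ℤ) → (ℕ → ℤ) → ℤ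
potential n a z Y = sumℤ (suc n) (λ i → z i * Mrow n a z i * (Y i * Y i))

-- Writing a vector as z Y turns the quadratic form into a sum of squares over the edges.
ground-state : ∀ n′ a z Y → let n = suc n′ in
  sumℤ (suc n) (λ i → z i * Y i * Mrow n a (λ k → z k * Y k) i) ≡ edgeEnergy n z Y + potential n a z Y
ground-state n′ a z Y = begin
  sumℤ (suc n) (λ i → z i * Y i * Mrow n a (λ k → z k * Y k) i)
    ≡⟨ sumℤ-cong (suc n) (λ i _ → pointwise i) ⟩
  sumℤ (suc n) (λ i → V i + indicator (i ℕ.<ᵇ n) * (P i (nextC n i) + P i (prevC n i)) + + δ i 0 * P i n + + δ i n * P i 0)
    ≡⟨ sumℤ-+ (suc n) _ _ ⟩
  sumℤ (suc n) (λ i → V i + indicator (i ℕ.<ᵇ n) * (P i (nextC n i) + P i (prevC n i)) + + δ i 0 * P i n) + Σδn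
    ≡⟨ cong (_+ Σδn) (sumℤ-+ (suc n) _ _) ⟩
  sumℤ (suc n) (λ i → V i + indicator (i ℕ.<ᵇ n) * (P i (nextC n i) + P i (prevC n i))) + Σδ0 + Σδn
    ≡⟨ cong (λ e → e + Σδ0 + Σδn) (sumℤ-+ (suc n) _ _) ⟩
  potential n a z Y + Σcycle + Σδ0 + Σδn
    ≡⟨ cong₂ (λ p q → potential n a z Y + p + Σδ0 + q) (sumℤ-cycle-neighbours n′ P)
             (sumℤ-δ (suc n) n (λ i → P i 0) (ℕP.n<1+n n)) ⟩
  potential n a z Y + sumℤ n (λ k → P k (nextC n k) + P (nextC n k) k) + Σδ0 + P n 0
    ≡⟨ cong₂ (λ p q → potential n a z Y + p + q + P n 0)
             (sumℤ-cong n (λ k _ → edge-square (z k) (z (nextC n k)) (Y k) (Y (nextC n k))))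
                                                        (sumℤ-δ (suc n) 0 (λ i → P i n) (s≤s z≤n)) ⟩
  potential n a z Y + cycle-energy + P 0 n + P n 0
    ≡⟨ regroup (potential n a z Y) cycle-energy (z 0) (z n) (Y 0) (Y n) ⟩
  edgeEnergy n z Y + potential n a z Y ∎
  where
  n = suc n′
  V : ℕ → ℤ
  V i = z i * Mrow n a z i * (Y i * Y i)
  P : ℕ → ℕ → ℤ
  P i p = z i * z p * (Y i * (Y i - Y p))
  Σδ0 = sumℤ (suc n) (λ i → + δ i 0 * P i n)
  Σδn = sumℤ (suc n) (λ i → + δ i n * P i 0)
  Σcycle = sumℤ (suc n) (λ i → indicator (i ℕ.<ᵇ n) * (P i (nextC n i) + P i (prevC n i)))
  cycle-energy = sumℤ n (λ k → z k * z (nextC n k) * ((Y k - Y (nextC n k)) * (Y k - Y (nextC n k))))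
  pointwise : ∀ i → z i * Y i * Mrow n a (λ k → z k * Y k) i ≡
    V i + indicator (i ℕ.<ᵇ n) * (P i (nextC n i) + P i (prevC n i)) + + δ i 0 * P i n + + δ i n * P i 0
  pointwise i = ring (a i) (z i) (Y i) (z (nextC n i)) (Y (nextC n i)) (z (prevC n i)) (Y (prevC n i))
                     (z n) (Y n) (z 0) (Y 0) (indicator (i ℕ.<ᵇ n)) (+ δ i 0) (+ δ i n)
    where ring : ∀ ai zi yi zx yx zp yp zn yn z0 y0 ι d0 dn →
            zi * yi * (ai * (zi * yi) - (ι * (zx * yx + zp * yp) + d0 * (zn * yn) + dn * (z0 * y0))) ≡
            zi * (ai * zi - (ι * (zx + zp) + d0 * zn + dn * z0)) * (yi * yi)
            + ι * (zi * zx * (yi * (yi - yx)) + zi * zp * (yi * (yi - yp)))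
            + d0 * (zi * zn * (yi * (yi - yn))) + dn * (zi * z0 * (yi * (yi - y0)))
          ring = solve-∀
  edge-square : ∀ p q r s → p * q * (r * (r - s)) + q * p * (s * (s - r)) ≡ p * q * ((r - s) * (r - s))
  edge-square = solve-∀
  regroup : ∀ A B p q r s → A + B + p * q * (r * (r - s)) + q * p * (s * (s - r)) ≡ B + p * q * ((r - s) * (r - s)) + A
  regroup = solve-∀

module _ (n′ : ℕ) (a z : ℕ → ℤ)
         (z>0 : ∀ k → k ℕ.< suc (suc n′) → + 0 ℤ.< z k)
         (Mz≥0 : ∀ i → i ℕ.< suc (suc n′) → + 0 ℤ.≤ Mrow (suc n′) a z i) where

  private
    n = suc n′

    next< : ∀ k → k ℕ.< n → nextC n k ℕ.< suc n
    next< k k< = ℕP.m<n⇒m<1+n (nextC-< n k k<)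

    0≤edge : ∀ (Y : ℕ → ℤ) k → k ℕ.< n → + 0 ℤ.≤ z k * z (nextC n k) * ((Y k - Y (nextC n k)) * (Y k - Y (nextC n k)))
    0≤edge Y k k< = 0≤i*j (z k * z (nextC n k)) _
      (ℤP.<⇒≤ (0<i*j (z k) (z (nextC n k)) (z>0 k (ℕP.m<n⇒m<1+n k<)) (z>0 _ (next< k k<))))
      (0≤i*i (Y k - Y (nextC n k)))

    0≤cycle : ∀ (Y : ℕ → ℤ) → + 0 ℤ.≤ sumℤ n (λ k → z k * z (nextC n k) * ((Y k - Y (nextC n k)) * (Y k - Y (nextC n k))))
    0≤cycle Y = sumℤ-nonneg n (λ k → z k * z (nextC n k) * ((Y k - Y (nextC n k)) * (Y k - Y (nextC n k)))) (0≤edge Y)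

    0≤pendant : ∀ (Y : ℕ → ℤ) → + 0 ℤ.≤ z 0 * z n * ((Y 0 - Y n) * (Y 0 - Y n))
    0≤pendant Y = 0≤i*j (z 0 * z n) _ (ℤP.<⇒≤ (0<i*j (z 0) (z n) (z>0 0 (s≤s z≤n)) (z>0 n (ℕP.n<1+n n)))) (0≤i*i (Y 0 - Y n))

    0≤potential-term : ∀ (Y : ℕ → ℤ) i → i ℕ.< suc n → + 0 ℤ.≤ z i * Mrow n a z i * (Y i * Y i)
    0≤potential-term Y i i< = 0≤i*j (z i * Mrow n a z i) (Y i * Y i)
      (0≤i*j (z i) (Mrow n a z i) (ℤP.<⇒≤ (z>0 i i<)) (Mz≥0 i i<)) (0≤i*i (Y i))

    0≤potential : ∀ (Y : ℕ → ℤ) → + 0 ℤ.≤ potential n a z Y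
    0≤potential Y = sumℤ-nonneg (suc n) (λ i → z i * Mrow n a z i * (Y i * Y i)) (0≤potential-term Y)

    quadℕ-zY : ∀ (Y : ℕ → ℤ) → quadℕ n a (λ k → z k * Y k) ≡ edgeEnergy n z Y + potential n a z Y
    quadℕ-zY Y = trans (sumℤ-cong (suc n) (λ i i< → cong (z i * Y i *_) (matVec-Mℕ n a (λ k → z k * Y k) i (s≤s z≤n) i<)))
                       (ground-state n′ a z Y)

    module Cleared (X : ℕ → ℤ) where
      cleared = clear-denominators (suc n) z X (λ k k< → 0<i⇒i≢0 (z k) (z>0 k k<))
      c = proj₁ cleared
      Y = proj₁ (proj₂ cleared)
      c≢0 = proj₁ (proj₂ (proj₂ cleared))
      cX≡zY = proj₂ (proj₂ (proj₂ cleared))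

      c²Q≡energy : c * c * quadℕ n a X ≡ edgeEnergy n z Y + potential n a z Y
      c²Q≡energy = trans (sym (quadℕ-scale n a c X))
        (trans (quadℕ-cong n a (λ k → c * X k) (λ k → z k * Y k) cX≡zY) (quadℕ-zY Y))

  quadℕ-nonneg : ∀ X → + 0 ℤ.≤ quadℕ n a X
  quadℕ-nonneg X = 0≤i*j⇒0≤j (c * c) (quadℕ n a X) (i≢0⇒0<i*i c c≢0) (subst (+ 0 ℤ.≤_) (sym c²Q≡energy)
    (ℤP.+-mono-≤ (ℤP.+-mono-≤ (0≤cycle Y) (0≤pendant Y)) (0≤potential Y)))
    where open Cleared X

  private
    -- A zero of the energy is constant along the connected graph and vanishes where M z > 0.
    null-energy : ∀ jj → jj ℕ.< suc n → + 0 ℤ.< Mrow n a z jj → ∀ (Y : ℕ → ℤ) →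
      edgeEnergy n z Y + potential n a z Y ≡ + 0 → ∀ k → k ℕ.< suc n → Y k ≡ + 0
    null-energy jj jj< 0<Mz Y energy≡0 k k< = trans (Y≡Y0 k k<) (trans (sym (Y≡Y0 jj jj<)) Yjj≡0)
      where
      cycle = sumℤ n (λ k → z k * z (nextC n k) * ((Y k - Y (nextC n k)) * (Y k - Y (nextC n k))))
      pendant = z 0 * z n * ((Y 0 - Y n) * (Y 0 - Y n))
      0≤edges = ℤP.+-mono-≤ (0≤cycle Y) (0≤pendant Y)
      edges≡0 = nonneg-+≡0ˡ (cycle + pendant) (potential n a z Y) 0≤edges (0≤potential Y) energy≡0
      potential≡0 = nonneg-+≡0ʳ (cycle + pendant) (potential n a z Y) 0≤edges (0≤potential Y) energy≡0
      difference≡0 : ∀ p q r s → + 0 ℤ.< p * q → p * q * ((r - s) * (r - s)) ≡ + 0 → r ≡ s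
      difference≡0 p q r s 0<pq e =
        ℤP.i-j≡0⇒i≡j r s (i*i≡0⇒i≡0 (r - s) (nonzero-cancel (p * q) ((r - s) * (r - s)) (0<i⇒i≢0 (p * q) 0<pq) e))
      along-edge : ∀ k → k ℕ.< n → Y k ≡ Y (nextC n k)
      along-edge k k< = difference≡0 (z k) (z (nextC n k)) (Y k) (Y (nextC n k))
        (0<i*j (z k) (z (nextC n k)) (z>0 k (ℕP.m<n⇒m<1+n k<)) (z>0 (nextC n k) (next< k k<)))
        (sumℤ-nonneg≡0 n (λ k → z k * z (nextC n k) * ((Y k - Y (nextC n k)) * (Y k - Y (nextC n k))))
          (0≤edge Y) (nonneg-+≡0ˡ cycle pendant (0≤cycle Y) (0≤pendant Y) edges≡0) k k<)
      along-pendant : Y 0 ≡ Y n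
      along-pendant = difference≡0 (z 0) (z n) (Y 0) (Y n) (0<i*j (z 0) (z n) (z>0 0 (s≤s z≤n)) (z>0 n (ℕP.n<1+n n)))
        (nonneg-+≡0ʳ cycle pendant (0≤cycle Y) (0≤pendant Y) edges≡0)
      Y≡Y0-on-cycle : ∀ k → k ℕ.< n → Y k ≡ Y 0
      Y≡Y0-on-cycle zero _ = refl
      Y≡Y0-on-cycle (suc k) k+1<n = begin
        Y (suc k)          ≡⟨ cong Y (sym (nextC-suc n k k+1<n)) ⟩
        Y (nextC n k)      ≡⟨ sym (along-edge k (ℕP.<-trans (ℕP.n<1+n k) k+1<n)) ⟩
        Y k                ≡⟨ Y≡Y0-on-cycle k (ℕP.<-trans (ℕP.n<1+n k) k+1<n) ⟩
        Y 0                ∎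
      Y≡Y0 : ∀ k → k ℕ.< suc n → Y k ≡ Y 0
      Y≡Y0 k (s≤s k≤n) with ℕP.m≤n⇒m<n∨m≡n k≤n
      ... | inj₁ k<n = Y≡Y0-on-cycle k k<n
      ... | inj₂ refl = sym along-pendant
      Yjj≡0 : Y jj ≡ + 0
      Yjj≡0 = i*i≡0⇒i≡0 (Y jj) (nonzero-cancel (z jj * Mrow n a z jj) (Y jj * Y jj)
        (0<i⇒i≢0 (z jj * Mrow n a z jj) (0<i*j (z jj) (Mrow n a z jj) (z>0 jj jj<) 0<Mz))
        (sumℤ-nonneg≡0 (suc n) (λ i → z i * Mrow n a z i * (Y i * Y i)) (0≤potential-term Y) potential≡0 jj jj<))

  quadℕ-pos : ∀ jj → jj ℕ.< suc n → + 0 ℤ.< Mrow n a z jj →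
    ∀ X k → k ℕ.< suc n → X k ≢ + 0 → + 0 ℤ.< quadℕ n a X
  quadℕ-pos jj jj< 0<Mz X k k< Xk≢0 = ℤP.≤∧≢⇒< (quadℕ-nonneg X) (Xk≢0 ∘ Xk≡0 ∘ sym)
    where
    open Cleared X
    Xk≡0 : quadℕ n a X ≡ + 0 → X k ≡ + 0
    Xk≡0 Q≡0 = nonzero-cancel c (X k) c≢0 (begin
      c * X k      ≡⟨ cX≡zY k k< ⟩
      z k * Y k    ≡⟨ cong (z k *_) (null-energy jj jj< 0<Mz Y energy≡0 k k<) ⟩
      z k * + 0    ≡⟨ ℤP.*-zeroʳ (z k) ⟩
      + 0          ∎)
      where energy≡0 = trans (sym c²Q≡energy) (trans (cong (c * c *_) Q≡0) (ℤP.*-zeroʳ (c * c)))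

-- Cokernels

sum-cong : ∀ {m} {f g : Fin m → ℤ} → (∀ i → f i ≡ g i) → Σ[ f ] ≡ Σ[ g ]
sum-cong {zero} _ = refl
sum-cong {suc m} f≗g = cong₂ _+_ (f≗g fzero) (sum-cong (f≗g ∘ fsuc))

sum-zero : ∀ {m} (f : Fin m → ℤ) → (∀ i → f i ≡ + 0) → Σ[ f ] ≡ + 0
sum-zero {zero} f _ = refl
sum-zero {suc m} f f≡0 = cong₂ _+_ (f≡0 fzero) (sum-zero (f ∘ fsuc) (f≡0 ∘ fsuc))

sum-lincomb : ∀ {m} (f g : Fin m → ℤ) p q → Σ[ (λ i → p * f i - q * g i) ] ≡ p * Σ[ f ] - q * Σ[ g ]
sum-lincomb {zero} f g p q = ring p q
  where ring : ∀ p q → + 0 ≡ p * + 0 - q * + 0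
        ring = solve-∀
sum-lincomb {suc m} f g p q =
  trans (cong (_+_ (p * f fzero - q * g fzero)) (sum-lincomb (f ∘ fsuc) (g ∘ fsuc) p q))
        (ring p q (f fzero) (g fzero) Σ[ f ∘ fsuc ] Σ[ g ∘ fsuc ])
  where ring : ∀ p q a b s t → p * a - q * b + (p * s - q * t) ≡ p * (a + s) - q * (b + t)
        ring = solve-∀

InIm-resp : ∀ {m} (M : Mat m) {y y′ : Vecℤ m} → (∀ i → y i ≡ y′ i) → InIm M y → InIm M y′
InIm-resp M y≗y′ (x , Mx≡y) = x , λ i → trans (Mx≡y i) (y≗y′ i)

InIm-zero : ∀ {m} (M : Mat m) → InIm M (λ _ → + 0)
InIm-zero M = (λ _ → + 0) , λ i → sum-zero (λ j → M i j * + 0) (λ j → ℤP.*-zeroʳ (M i j))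

InIm-lincomb : ∀ {m} (M : Mat m) {y y′ : Vecℤ m} p q → InIm M y → InIm M y′ → InIm M (λ i → p * y i - q * y′ i)
InIm-lincomb M {y} {y′} p q (x , Mx≡y) (x′ , Mx′≡y′) = (λ j → p * x j - q * x′ j) , λ i → begin
  Σ[ (λ j → M i j * (p * x j - q * x′ j)) ]
    ≡⟨ sum-cong (λ j → distrib (M i j) (x j) (x′ j) p q) ⟩
  Σ[ (λ j → p * (M i j * x j) - q * (M i j * x′ j)) ]
    ≡⟨ sum-lincomb (λ j → M i j * x j) (λ j → M i j * x′ j) p q ⟩
  p * (M · x) i - q * (M · x′) i
    ≡⟨ cong₂ (λ u v → p * u - q * v) (Mx≡y i) (Mx′≡y′ i) ⟩
  p * y i - q * y′ i ∎
  where distrib : ∀ a b c p q → a * (p * b - q * c) ≡ p * (a * b) - q * (a * c)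
        distrib = solve-∀

-- The torsion subgroup of a cyclic group is cyclic: generated by e itself or trivial.
cyclic-quotient⇒PhiCyclic : ∀ {m} (M : Mat m) e →
  (∀ y → ∃ λ (c : ℤ) → InIm M (λ i → y i - c * e i)) →
  IsTorsion M e ⊎ (∀ k → InIm M (λ i → k * e i) → k ≡ + 0) → PhiCyclic M
cyclic-quotient⇒PhiCyclic M e generated (inj₁ e-torsion) = e , e-torsion , λ y _ → generated y
cyclic-quotient⇒PhiCyclic M e generated (inj₂ e-free) =
  (λ _ → + 0) , (+ 1 , (λ ()) , InIm-zero M) , λ y (k , k≢0 , ky∈Im) → + 0 , y∈Im y k k≢0 ky∈Im
  where
  y∈Im : ∀ y k → k ≢ + 0 → InIm M (λ i → k * y i) → InIm M (λ i → y i - + 0 * + 0)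
  y∈Im y k k≢0 ky∈Im with generated y
  ... | c , y-ce∈Im = InIm-resp M y-ce≡y y-ce∈Im
    where
    kce∈Im : InIm M (λ i → k * c * e i)
    kce∈Im = InIm-resp M (λ i → ring k c (y i) (e i)) (InIm-lincomb M (+ 1) k ky∈Im y-ce∈Im)
      where ring : ∀ k c y e → + 1 * (k * y) - k * (y - c * e) ≡ k * c * e
            ring = solve-∀
    c≡0 : c ≡ + 0
    c≡0 = nonzero-cancel k c k≢0 (e-free (k * c) kce∈Im)
    y-ce≡y : ∀ i → y i - c * e i ≡ y i - + 0 * + 0
    y-ce≡y i = cong (λ v → y i - v * e i) c≡0

extendℕ : ∀ {m} → Vecℤ m → ℕ → ℤ
extendℕ {zero} X k = + 0
extendℕ {suc m} X zero = X fzero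
extendℕ {suc m} X (suc k) = extendℕ (X ∘ fsuc) k

extendℕ-toℕ : ∀ {m} (X : Vecℤ m) i → extendℕ X (toℕ i) ≡ X i
extendℕ-toℕ X fzero = refl
extendℕ-toℕ X (fsuc i) = extendℕ-toℕ (X ∘ fsuc) i

extendℕ-tabulate : ∀ {m} (f : ℕ → ℤ) r → r ℕ.< m → extendℕ {m} (λ i → f (toℕ i)) r ≡ f r
extendℕ-tabulate {suc m} f zero _ = refl
extendℕ-tabulate {suc m} f (suc r) (s≤s r<m) = extendℕ-tabulate (f ∘ suc) r r<m

·-toℕ : ∀ n a (x : Vecℤ (suc n)) (x′ : ℕ → ℤ) → (∀ i → x i ≡ x′ (toℕ i)) →
  ∀ i → (M-Cplus n (λ i → a (toℕ i)) · x) i ≡ matVec (suc n) (Mℕ n a) x′ (toℕ i)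
·-toℕ n a x x′ x≗x′ i = sum-toℕ (suc n) _ _ (λ j → cong (Mℕ n a (toℕ i) (toℕ j) *_) (x≗x′ j))

quad-toℕ : ∀ n a (X : Vecℤ (suc n)) → quad (M-Cplus n (λ i → a (toℕ i))) X ≡ quadℕ n a (extendℕ X)
quad-toℕ n a X = sum-toℕ (suc n) _ _ λ i → begin
  Σ[ (λ j → X i * (Mℕ n a (toℕ i) (toℕ j) * X j)) ]
    ≡⟨ sum-toℕ (suc n) _ (λ j → X i * (Mℕ n a (toℕ i) j * extendℕ X j))
         (λ j → cong (λ v → X i * (Mℕ n a (toℕ i) (toℕ j) * v)) (sym (extendℕ-toℕ X j))) ⟩
  sumℤ (suc n) (λ j → X i * (Mℕ n a (toℕ i) j * extendℕ X j))
    ≡⟨ sym (sumℤ-*ˡ (suc n) (X i) _) ⟩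
  X i * matVec (suc n) (Mℕ n a) (extendℕ X) (toℕ i)
    ≡⟨ cong (_* matVec (suc n) (Mℕ n a) (extendℕ X) (toℕ i)) (sym (extendℕ-toℕ X i)) ⟩
  extendℕ X (toℕ i) * matVec (suc n) (Mℕ n a) (extendℕ X) (toℕ i) ∎

InIm-fromℕ : ∀ n a (y : Vecℤ (suc n)) (x y′ : ℕ → ℤ) → (∀ i → y i ≡ y′ (toℕ i)) →
  (∀ r → r ℕ.< suc n → matVec (suc n) (Mℕ n a) x r ≡ y′ r) → InIm (M-Cplus n (λ i → a (toℕ i))) y
InIm-fromℕ n a y x y′ y≗y′ Mx≡y′ = (λ i → x (toℕ i)) , λ i →
  trans (·-toℕ n a (λ i → x (toℕ i)) x (λ _ → refl) i) (trans (Mx≡y′ (toℕ i) (toℕ<n i)) (sym (y≗y′ i)))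

InIm-toℕ : ∀ n a (y : Vecℤ (suc n)) → InIm (M-Cplus n (λ i → a (toℕ i))) y →
  ∃ λ (x : ℕ → ℤ) → ∀ r → r ℕ.< suc n → matVec (suc n) (Mℕ n a) x r ≡ extendℕ y r
InIm-toℕ n a y (x , Mx≡y) = extendℕ x , λ r r< →
  subst (λ q → matVec (suc n) (Mℕ n a) (extendℕ x) q ≡ extendℕ y q) (toℕ-fromℕ< r<)
    (trans (sym (·-toℕ n a x (extendℕ x) (sym ∘ extendℕ-toℕ x) (fromℕ< r<)))
           (trans (Mx≡y (fromℕ< r<)) (sym (extendℕ-toℕ y (fromℕ< r<)))))

det-minor00-toℕ : ∀ n a → det (minor fzero fzero (M-Cplus n (λ i → a (toℕ i)))) ≡ detℕ n (minorℕ 0 (Mℕ n a))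
det-minor00-toℕ n a = det-toℕ n (minor fzero fzero (M-Cplus n (λ i → a (toℕ i)))) (minorℕ 0 (Mℕ n a)) (λ _ _ → refl)

det-toℕ-Mℕ : ∀ n a → det (M-Cplus n (λ i → a (toℕ i))) ≡ detℕ (suc n) (Mℕ n a)
det-toℕ-Mℕ n a = det-toℕ (suc n) (M-Cplus n (λ i → a (toℕ i))) (Mℕ n a) (λ _ _ → refl)

-- Elements of V_G(2)

surjective⇒PhiCyclic : ∀ {m} (M : Mat m) → (∀ y → InIm M y) → PhiCyclic M
surjective⇒PhiCyclic M surjective = cyclic-quotient⇒PhiCyclic M (λ _ → + 0)
  (λ y → + 0 , InIm-resp M (λ i → sym (ℤP.+-identityʳ (y i))) (surjective y))
  (inj₁ (+ 1 , (λ ()) , InIm-zero M))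

Mℕ-surjective : ∀ n a → detℕ (suc n) (Mℕ n a) ≡ + 1 → ∀ y → InIm (M-Cplus n (λ i → a (toℕ i))) y
Mℕ-surjective n a det≡1 y = InIm-fromℕ n a y (proj₁ solution) (extendℕ y) (sym ∘ extendℕ-toℕ y) (proj₂ solution)
  where solution = detℕ≡1⇒surjective n (Mℕ n a) det≡1 (extendℕ y)

InV-one : ∀ m (a w : ℕ → ℤ) → (∀ k → + 2 ℤ.≤ a k) →
  (∀ i → i ℕ.< suc (suc (suc m)) → Mrow (suc (suc m)) a w i ≡ + δ i 0) →
  w 0 ≡ a (suc (suc m)) * continuant a (suc m) 1 →
  (∀ k → k ℕ.< suc (suc (suc m)) → + 0 ℤ.< w k) →
  InV (suc (suc m)) (+ 2) 1
InV-one m a w a≥2 Mw≡e₀ w0≡D w>0 =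
  (λ i → a (toℕ i)) , (λ i → a≥2 (toℕ i)) , trans (det-toℕ-Mℕ n a) detℕ≡1 ,
  (λ _ → posdef) , (λ ()) , surjective⇒PhiCyclic (M-Cplus n (λ i → a (toℕ i))) (Mℕ-surjective n a detℕ≡1)
  where
  n = suc (suc m)
  F = Mℕ n a
  -- Pairing w with the first-row cofactors c: w 0 * det F = Σ (F w)_j c_j = c 0 = w 0.
  detℕ≡1 : detℕ (suc n) F ≡ + 1
  detℕ≡1 = ℤP.*-cancelˡ-≡ (w 0) _ _ {{ℤ.≢-nonZero (0<i⇒i≢0 (w 0) (w>0 0 (s≤s z≤n)))}} w0*det≡w0*1
    where
    w0*det≡w0*1 : w 0 * detℕ (suc n) F ≡ w 0 * + 1
    w0*det≡w0*1 = begin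
      w 0 * detℕ (suc n) F
        ≡⟨ cofactor-pairing n F (Mℕ-sym n a) w ⟩
      sumℤ (suc n) (λ j → matVec (suc n) F w j * cofactor n F j)
        ≡⟨ sumℤ-cong (suc n) (λ j j< → cong (_* cofactor n F j) (trans (matVec-Mℕ n a w j (s≤s z≤n) j<) (Mw≡e₀ j j<))) ⟩
      sumℤ (suc n) (λ j → + δ j 0 * cofactor n F j)
        ≡⟨ sumℤ-δ (suc n) 0 (cofactor n F) (s≤s z≤n) ⟩
      + 1 * detℕ n (minorℕ 0 F)
        ≡⟨ ℤP.*-identityˡ _ ⟩
      detℕ n (minorℕ 0 F)
        ≡⟨ trans (detℕ-minor00-Mℕ m a) (sym w0≡D) ⟩
      w 0
        ≡⟨ sym (ℤP.*-identityʳ (w 0)) ⟩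
      w 0 * + 1 ∎
  posdef : PosDef (M-Cplus n (λ i → a (toℕ i)))
  posdef X (i , Xi≢0) = subst (+ 0 ℤ.<_) (sym (quad-toℕ n a X))
    (quadℕ-pos (suc m) a w w>0 (λ i i< → subst (+ 0 ℤ.≤_) (sym (Mw≡e₀ i i<)) (ℤ.+≤+ z≤n))
      0 (s≤s z≤n) (subst (+ 0 ℤ.<_) (sym (Mw≡e₀ 0 (s≤s z≤n))) (ℤ.+<+ (s≤s z≤n)))
      (extendℕ X) (toℕ i) (toℕ<n i) (λ e → Xi≢0 (trans (sym (extendℕ-toℕ X i)) e)))

setAt : ℕ → ℤ → (ℕ → ℤ) → ℕ → ℤ
setAt j t a k = if k ≡ᵇ j then t else a k

setAt-shift : ∀ j t s a (x : ℕ → ℤ) i → (setAt j t a i - setAt j s a i) * x i ≡ (t - s) * x j * + δ i j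
setAt-shift j t s a x i with i ℕP.≟ j
... | yes refl rewrite ≡ᵇ-refl i = sym (ℤP.*-identityʳ _)
... | no i≢j rewrite ≡ᵇ-≢ i j i≢j = trans (cong (_* x i) (ℤP.+-inverseʳ (a i)))
  (trans (ℤP.*-zeroˡ (x i)) (sym (ℤP.*-zeroʳ ((t - s) * x j))))

Mℕ-setAt-off : ∀ n j t s a r c → c ≢ j → Mℕ n (setAt j t a) r c ≡ Mℕ n (setAt j s a) r c
Mℕ-setAt-off n j t s a r c c≢j with r ℕP.≟ c
... | yes refl rewrite ≡ᵇ-refl r | ≡ᵇ-≢ r j c≢j = refl
... | no r≢c rewrite ≡ᵇ-≢ r c r≢c = refl

-- The one-parameter family setAt jj t a: M z = (t - β) e_jj for the positive vector z,
-- so det M = t - β, M is positive (semi)definite, and e_jj generates the cokernel.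
module Family (m : ℕ) (a z : ℕ → ℤ) (jj : ℕ) (β : ℤ)
  (jj< : jj ℕ.< suc (suc (suc m)))
  (a≥2 : ∀ k → + 2 ℤ.≤ a k) (β≥2 : + 2 ℤ.≤ β)
  (Mz≡0 : ∀ i → i ℕ.< suc (suc (suc m)) → Mrow (suc (suc m)) (setAt jj β a) z i ≡ + 0)
  (zjj≡1 : z jj ≡ + 1)
  (z>0 : ∀ k → k ℕ.< suc (suc (suc m)) → + 0 ℤ.< z k)
  (minor≡z0² : setAt jj β a (suc (suc m)) * continuant (setAt jj β a) (suc m) 1 ≡ z 0 * z 0) where

  private
    n = suc (suc m)

    F : ℤ → Matℕ
    F t = Mℕ n (setAt jj t a)

    z0≢0 : z 0 ≢ + 0
    z0≢0 = 0<i⇒i≢0 (z 0) (z>0 0 (s≤s z≤n))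

    Mrow-z : ∀ t i → i ℕ.< suc n → Mrow n (setAt jj t a) z i ≡ (t - β) * + δ i jj
    Mrow-z t i i< = begin
      Mrow n (setAt jj t a) z i
        ≡⟨ Mrow-diagonal-shift n (setAt jj t a) (setAt jj β a) z i ⟩
      Mrow n (setAt jj β a) z i + (setAt jj t a i - setAt jj β a i) * z i
        ≡⟨ cong₂ _+_ (Mz≡0 i i<) (setAt-shift jj t β a z i) ⟩
      + 0 + (t - β) * z jj * + δ i jj
        ≡⟨ cong (λ v → + 0 + (t - β) * v * + δ i jj) zjj≡1 ⟩
      + 0 + (t - β) * + 1 * + δ i jj
        ≡⟨ ring (t - β) (+ δ i jj) ⟩
      (t - β) * + δ i jj ∎
      where ring : ∀ p d → + 0 + p * + 1 * d ≡ p * d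
            ring = solve-∀

    Fz : ∀ t i → i ℕ.< suc n → matVec (suc n) (F t) z i ≡ (t - β) * + δ i jj
    Fz t i i< = trans (matVec-Mℕ n (setAt jj t a) z i (s≤s z≤n) i<) (Mrow-z t i i<)

    minorβ≡z0² : detℕ n (minorℕ 0 (F β)) ≡ z 0 * z 0
    minorβ≡z0² = trans (detℕ-minor00-Mℕ m (setAt jj β a)) minor≡z0²

    cofactorβ-jj : cofactor n (F β) jj ≡ z 0
    cofactorβ-jj = ℤP.*-cancelˡ-≡ (z 0) _ _ {{ℤ.≢-nonZero z0≢0}} (begin
      z 0 * cofactor n (F β) jj
        ≡⟨ cofactors-proportional (suc m) (F β) (Mℕ-sym n (setAt jj β a))
             (λ e → z0≢0 (i*i≡0⇒i≡0 (z 0) (trans (sym minorβ≡z0²) e))) z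
             (λ i i< → trans (Fz β (suc i) (s≤s i<))
                         (trans (cong (_* + δ (suc i) jj) (ℤP.+-inverseʳ β)) (ℤP.*-zeroˡ (+ δ (suc i) jj))))
             jj jj< ⟩
      cofactor n (F β) 0 * z jj
        ≡⟨ cong₂ _*_ (trans (ℤP.*-identityˡ _) minorβ≡z0²) zjj≡1 ⟩
      z 0 * z 0 * + 1
        ≡⟨ ℤP.*-identityʳ _ ⟩
      z 0 * z 0 ∎)

  detℕ-family : ∀ t → detℕ (suc n) (F t) ≡ t - β
  detℕ-family t = ℤP.*-cancelˡ-≡ (z 0) _ _ {{ℤ.≢-nonZero z0≢0}} (begin
    z 0 * detℕ (suc n) (F t)
      ≡⟨ cofactor-pairing n (F t) (Mℕ-sym n (setAt jj t a)) z ⟩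
    sumℤ (suc n) (λ j → matVec (suc n) (F t) z j * cofactor n (F t) j)
      ≡⟨ sumℤ-cong (suc n) (λ j j< → trans (cong (_* cofactor n (F t) j) (Fz t j j<)) (ℤP.*-assoc (t - β) _ _)) ⟩
    sumℤ (suc n) (λ j → (t - β) * (+ δ j jj * cofactor n (F t) j))
      ≡⟨ sym (sumℤ-*ˡ (suc n) (t - β) _) ⟩
    (t - β) * sumℤ (suc n) (λ j → + δ j jj * cofactor n (F t) j)
      ≡⟨ cong ((t - β) *_) (sumℤ-δ (suc n) jj (cofactor n (F t)) jj<) ⟩
    (t - β) * cofactor n (F t) jj
      ≡⟨ cong ((t - β) *_) (trans (cofactor-cong n (F t) (F β) jj (λ r c _ _ → Mℕ-setAt-off n jj t β a (suc r) c)) cofactorβ-jj) ⟩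
    (t - β) * z 0
      ≡⟨ ℤP.*-comm (t - β) (z 0) ⟩
    z 0 * (t - β) ∎)

  private
    surjective-β+1 : ∀ y → ∃ λ (x : ℕ → ℤ) → ∀ r → r ℕ.< suc n → matVec (suc n) (F (β + + 1)) x r ≡ y r
    surjective-β+1 = detℕ≡1⇒surjective n (F (β + + 1)) (trans (detℕ-family (β + + 1)) (ring β))
      where ring : ∀ b → b + + 1 - b ≡ + 1
            ring = solve-∀

    congruent-to-ejj : ∀ t (y : Vecℤ (suc n)) →
      ∃ λ (c : ℤ) → InIm (M-Cplus n (λ i → setAt jj t a (toℕ i))) (λ i → y i - c * + δ (toℕ i) jj)
    congruent-to-ejj t y = c , InIm-fromℕ n (setAt jj t a) (λ i → y i - c * + δ (toℕ i) jj) x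
      (λ r → extendℕ y r - c * + δ r jj) (λ i → cong (λ v → v - c * + δ (toℕ i) jj) (sym (extendℕ-toℕ y i))) Fx≡
      where
      t′ = β + + 1
      x = proj₁ (surjective-β+1 (extendℕ y))
      F′x≡y = proj₂ (surjective-β+1 (extendℕ y))
      c = (t′ - t) * x jj
      Fx≡ : ∀ r → r ℕ.< suc n → matVec (suc n) (F t) x r ≡ extendℕ y r - c * + δ r jj
      Fx≡ r r< = begin
        matVec (suc n) (F t) x r
          ≡⟨ matVec-Mℕ n (setAt jj t a) x r (s≤s z≤n) r< ⟩
        Mrow n (setAt jj t a) x r
          ≡⟨ Mrow-diagonal-shift n (setAt jj t a) (setAt jj t′ a) x r ⟩
        Mrow n (setAt jj t′ a) x r + (setAt jj t a r - setAt jj t′ a r) * x r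
          ≡⟨ cong₂ _+_ (trans (sym (matVec-Mℕ n (setAt jj t′ a) x r (s≤s z≤n) r<)) (F′x≡y r r<))
                       (setAt-shift jj t t′ a x r) ⟩
        extendℕ y r + (t - t′) * x jj * + δ r jj
          ≡⟨ ring (extendℕ y r) t t′ (x jj) (+ δ r jj) ⟩
        extendℕ y r - c * + δ r jj ∎
        where ring : ∀ y t t′ x d → y + (t - t′) * x * d ≡ y - (t′ - t) * x * d
              ring = solve-∀

  module _ (u : ℕ) where
    private
      t = + u + β
      aₜ = setAt jj t a
      M = M-Cplus n (λ i → aₜ (toℕ i))

      t-β≡u : t - β ≡ + u
      t-β≡u = ring (+ u) β
        where ring : ∀ p q → p + q - q ≡ p
              ring = solve-∀

      aₜ≥2 : ∀ k → + 2 ℤ.≤ aₜ k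
      aₜ≥2 k with k ℕP.≟ jj
      ... | yes refl rewrite ≡ᵇ-refl k = ℤP.i≤j⇒i≤k+j (+ u) β≥2
      ... | no k≢jj rewrite ≡ᵇ-≢ k jj k≢jj = a≥2 k

      det≡u : det M ≡ + u
      det≡u = trans (det-toℕ-Mℕ n aₜ) (trans (detℕ-family t) t-β≡u)

      Mz≡uδ : ∀ i → i ℕ.< suc n → Mrow n aₜ z i ≡ + u * + δ i jj
      Mz≡uδ i i< = trans (Mrow-z t i i<) (cong (_* + δ i jj) t-β≡u)

      Mz≥0 : ∀ i → i ℕ.< suc n → + 0 ℤ.≤ Mrow n aₜ z i
      Mz≥0 i i< = subst (+ 0 ℤ.≤_) (sym (Mz≡uδ i i<)) (0≤i*j (+ u) (+ δ i jj) (ℤ.+≤+ z≤n) (ℤ.+≤+ z≤n))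

      posdef : u ≢ 0 → PosDef M
      posdef u≢0 X (i , Xi≢0) = subst (+ 0 ℤ.<_) (sym (quad-toℕ n aₜ X))
        (quadℕ-pos (suc m) aₜ z z>0 Mz≥0 jj jj<
          (subst (+ 0 ℤ.<_) (sym (trans (Mz≡uδ jj jj<) (cong (λ d → + u * + d) (δ-refl jj))))
                 (subst (+ 0 ℤ.<_) (sym (ℤP.*-identityʳ (+ u))) (ℤ.+<+ (ℕP.n≢0⇒n>0 u≢0))))
          (extendℕ X) (toℕ i) (toℕ<n i) (λ e → Xi≢0 (trans (sym (extendℕ-toℕ X i)) e)))

      semidef-rank : u ≡ 0 → PosSemiDef M × RankPred M
      semidef-rank u≡0 = psd , trans det≡u (cong +_ u≡0) , fzero , fzero , minor≢0
        where
        psd : PosSemiDef M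
        psd X = subst (+ 0 ℤ.≤_) (sym (quad-toℕ n aₜ X)) (quadℕ-nonneg (suc m) aₜ z z>0 Mz≥0 (extendℕ X))
        minor≢0 : det (minor fzero fzero M) ≢ + 0
        minor≢0 e = z0≢0 (i*i≡0⇒i≡0 (z 0) (begin
          z 0 * z 0                ≡⟨ sym minorβ≡z0² ⟩
          detℕ n (minorℕ 0 (F β))  ≡⟨ cong (λ s → detℕ n (minorℕ 0 (F s)))
                                          (sym (trans (cong (λ v → + v + β) u≡0) (ℤP.+-identityˡ β))) ⟩
          detℕ n (minorℕ 0 (F t))  ≡⟨ sym (det-minor00-toℕ n aₜ) ⟩
          det (minor fzero fzero M) ≡⟨ e ⟩
          + 0                      ∎))

      ejj : Vecℤ (suc n)
      ejj i = + δ (toℕ i) jj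

      ejj-torsion : u ≢ 0 → IsTorsion M ejj
      ejj-torsion u≢0 = + u , u≢0 ∘ ℤP.+-injective ,
        InIm-fromℕ n aₜ (λ i → + u * ejj i) z (λ r → + u * + δ r jj) (λ _ → refl)
          (λ r r< → trans (matVec-Mℕ n aₜ z r (s≤s z≤n) r<) (Mz≡uδ r r<))

      -- Pairing with the kernel vector z: k = Σ_r z_r (F x)_r = Σ_j (F z)_j x_j = 0.
      ejj-free : u ≡ 0 → ∀ k → InIm M (λ i → k * ejj i) → k ≡ + 0
      ejj-free u≡0 k kejj∈Im = begin
        k                                                   ≡⟨ sym (trans (cong (k *_) zjj≡1) (ℤP.*-identityʳ k)) ⟩
        k * z jj                                            ≡⟨ sym (sumℤ-δ (suc n) jj (λ r → k * z r) jj<) ⟩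
        sumℤ (suc n) (λ r → + δ r jj * (k * z r))           ≡⟨ sumℤ-cong (suc n) pairing-term ⟩
        sumℤ (suc n) (λ r → z r * matVec (suc n) (F t) x r) ≡⟨ pairing-symmetric (suc n) (F t) (Mℕ-sym n aₜ) z x ⟩
        sumℤ (suc n) (λ j → matVec (suc n) (F t) z j * x j) ≡⟨ sumℤ-zero (suc n) Fz≡0 ⟩
        + 0                                                 ∎
        where
        x = proj₁ (InIm-toℕ n aₜ (λ i → k * ejj i) kejj∈Im)
        Fx≡kejj = proj₂ (InIm-toℕ n aₜ (λ i → k * ejj i) kejj∈Im)
        pairing-term : ∀ r → r ℕ.< suc n → + δ r jj * (k * z r) ≡ z r * matVec (suc n) (F t) x r
        pairing-term r r< = begin
          + δ r jj * (k * z r)    ≡⟨ ring (+ δ r jj) k (z r) ⟩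
          z r * (k * + δ r jj)    ≡⟨ cong (z r *_) (sym (trans (Fx≡kejj r r<) (extendℕ-tabulate (λ r → k * + δ r jj) r r<))) ⟩
          z r * matVec (suc n) (F t) x r ∎
          where ring : ∀ d k z → d * (k * z) ≡ z * (k * d)
                ring = solve-∀
        Fz≡0 : ∀ j → j ℕ.< suc n → matVec (suc n) (F t) z j * x j ≡ + 0
        Fz≡0 j j< = begin
          matVec (suc n) (F t) z j * x j   ≡⟨ cong (_* x j) (trans (matVec-Mℕ n aₜ z j (s≤s z≤n) j<) (Mz≡uδ j j<)) ⟩
          + u * + δ j jj * x j             ≡⟨ cong (λ v → + v * + δ j jj * x j) u≡0 ⟩
          + 0 * x j                        ≡⟨ ℤP.*-zeroˡ (x j) ⟩
          + 0                              ∎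

      ejj-order : Dec (u ≡ 0) → IsTorsion M ejj ⊎ (∀ k → InIm M (λ i → k * ejj i) → k ≡ + 0)
      ejj-order (no u≢0) = inj₁ (ejj-torsion u≢0)
      ejj-order (yes u≡0) = inj₂ (ejj-free u≡0)

    InV-family : InV (suc (suc m)) (+ 2) u
    InV-family = (λ i → aₜ (toℕ i)) , (λ i → aₜ≥2 (toℕ i)) , det≡u , posdef , semidef-rank ,
      cyclic-quotient⇒PhiCyclic M ejj (congruent-to-ejj t) (ejj-order (u ℕP.≟ 0))

-- Explicit weights

continuant-twos : ∀ a l s → (∀ k → s ℕ.≤ k → a k ≡ + 2) → continuant a l s ≡ + suc l
continuant-twos a zero s _ = refl
continuant-twos a (suc zero) s twos = twos s ℕP.≤-refl
continuant-twos a (suc (suc l)) s twos = begin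
  a s * continuant a (suc l) (suc s) - continuant a l (suc (suc s))
    ≡⟨ cong₂ (λ p q → p * q - continuant a l (suc (suc s))) (twos s ℕP.≤-refl)
             (continuant-twos a (suc l) (suc s) (λ k s<k → twos k (ℕP.<⇒≤ s<k))) ⟩
  + 2 * + suc (suc l) - continuant a l (suc (suc s))
    ≡⟨ cong (_-_ (+ 2 * + suc (suc l)))
            (continuant-twos a l (suc (suc s)) (λ k s+2≤k → twos k (ℕP.≤-trans (ℕP.n≤1+n s) (ℕP.≤-trans (ℕP.n≤1+n (suc s)) s+2≤k)))) ⟩
  + 2 * + suc (suc l) - + suc l
    ≡⟨ cong₂ (λ p q → + 2 * p - q) (ℤP.pos-+ 2 l) (ℤP.pos-+ 1 l) ⟩
  + 2 * (+ 2 + + l) - (+ 1 + + l)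
    ≡⟨ ring (+ l) ⟩
  + 3 + + l
    ≡⟨ sym (ℤP.pos-+ 3 l) ⟩
  + suc (suc (suc l)) ∎
  where ring : ∀ L → + 2 * (+ 2 + L) - (+ 1 + L) ≡ + 3 + L
        ring = solve-∀

-- Weights with determinant 1 on every C_n^+.
a-det1 : ℕ → ℤ
a-det1 k = if k ≡ᵇ 1 then + 3 else + 2

a-det1≥2 : ∀ k → + 2 ℤ.≤ a-det1 k
a-det1≥2 k with k ≡ᵇ 1
... | true = ℤ.+≤+ (s≤s (s≤s z≤n))
... | false = ℤP.≤-refl

continuant-a-det1 : ∀ m → continuant a-det1 (suc m) 1 ≡ + 2 * + m + + 3
continuant-a-det1 zero = refl
continuant-a-det1 (suc m) = begin
  + 3 * continuant a-det1 (suc m) 2 - continuant a-det1 m 3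
    ≡⟨ cong₂ (λ p q → + 3 * p - q) (continuant-twos a-det1 (suc m) 2 twos)
             (continuant-twos a-det1 m 3 (λ k 3≤k → twos k (ℕP.<⇒≤ 3≤k))) ⟩
  + 3 * + suc (suc m) - + suc m
    ≡⟨ cong₂ (λ p q → + 3 * p - q) (ℤP.pos-+ 2 m) (ℤP.pos-+ 1 m) ⟩
  + 3 * (+ 2 + + m) - (+ 1 + + m)
    ≡⟨ ring (+ m) ⟩
  + 2 * (+ 1 + + m) + + 3
    ≡⟨ cong (λ p → + 2 * p + + 3) (sym (ℤP.pos-+ 1 m)) ⟩
  + 2 * + suc m + + 3 ∎
  where
  twos : ∀ k → 2 ℕ.≤ k → a-det1 k ≡ + 2
  twos (suc zero) (s≤s ())
  twos (suc (suc k)) _ = refl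
  ring : ∀ M → + 3 * (+ 2 + M) - (+ 1 + M) ≡ + 2 * (+ 1 + M) + + 3
  ring = solve-∀

w-det1 : ℕ → ℕ → ℤ
w-det1 m zero = + 4 * + m + + 6
w-det1 m (suc k) = if k ≡ᵇ suc m then + 2 * + m + + 3 else + 2 * + m + + 4 + + 2 * + k

w-det1-cycle : ∀ m k → k ℕ.≤ m → w-det1 m (suc k) ≡ + 2 * + m + + 4 + + 2 * + k
w-det1-cycle m k k≤m rewrite ≡ᵇ-≢ k (suc m) (ℕP.<⇒≢ (s≤s k≤m)) = refl

w-det1-pendant : ∀ m → w-det1 m (suc (suc m)) ≡ + 2 * + m + + 3
w-det1-pendant m rewrite ≡ᵇ-refl m = refl

w-det1>0 : ∀ m k → + 0 ℤ.< w-det1 m k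
w-det1>0 m zero = 0<c*x+suc 4 (+ m) 5 (ℤ.+≤+ z≤n)
w-det1>0 m (suc k) with k ≡ᵇ suc m
... | true = 0<c*x+suc 2 (+ m) 2 (ℤ.+≤+ z≤n)
... | false = ℤP.+-mono-<-≤ (0<c*x+suc 2 (+ m) 3 (ℤ.+≤+ z≤n)) (0≤i*j (+ 2) (+ k) (ℤ.+≤+ z≤n) (ℤ.+≤+ z≤n))

w-det1-last-row : ∀ m → a-det1 (suc m) * w-det1 m (suc m) - w-det1 m 0 - w-det1 m m ≡ + 0
w-det1-last-row zero = refl
w-det1-last-row (suc m) rewrite w-det1-cycle (suc m) (suc m) ℕP.≤-refl | w-det1-cycle (suc m) m (ℕP.n≤1+n m) | ℤP.pos-+ 1 m = ring (+ m)
  where ring : ∀ M → + 2 * (+ 2 * (+ 1 + M) + + 4 + + 2 * (+ 1 + M)) - (+ 4 * (+ 1 + M) + + 6) - (+ 2 * (+ 1 + M) + + 4 + + 2 * M) ≡ + 0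
        ring = solve-∀

Mrow-w-det1 : ∀ m i → i ℕ.< suc (suc (suc m)) → Mrow (suc (suc m)) a-det1 (w-det1 m) i ≡ + δ i 0
Mrow-w-det1 m = Mrow-by-cases m a-det1 (w-det1 m) (λ i → + δ i 0) row-0 inner (w-det1-last-row m) pendant
  where
  row-0 : + 2 * w-det1 m 0 - w-det1 m 1 - w-det1 m (suc m) - w-det1 m (suc (suc m)) ≡ + 1
  row-0 rewrite w-det1-cycle m m ℕP.≤-refl | w-det1-pendant m = ring (+ m)
    where ring : ∀ M → + 2 * (+ 4 * M + + 6) - (+ 2 * M + + 4 + + 2 * + 0) - (+ 2 * M + + 4 + + 2 * M) - (+ 2 * M + + 3) ≡ + 1
          ring = solve-∀
  inner : ∀ k → suc (suc k) ℕ.< suc (suc m) →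
    a-det1 (suc k) * w-det1 m (suc k) - w-det1 m (suc (suc k)) - w-det1 m k ≡ + 0
  inner zero k+2<n rewrite w-det1-cycle m 1 (ℕP.≤-pred (ℕP.≤-pred k+2<n)) = ring (+ m)
    where ring : ∀ M → + 3 * (+ 2 * M + + 4 + + 2 * + 0) - (+ 2 * M + + 4 + + 2 * + 1) - (+ 4 * M + + 6) ≡ + 0
          ring = solve-∀
  inner (suc k) k+2<n rewrite w-det1-cycle m (suc k) (ℕP.<⇒≤ (ℕP.≤-pred (ℕP.≤-pred k+2<n)))
    | w-det1-cycle m (suc (suc k)) (ℕP.≤-pred (ℕP.≤-pred k+2<n))
    | w-det1-cycle m k (ℕP.≤-trans (ℕP.n≤1+n k) (ℕP.<⇒≤ (ℕP.≤-pred (ℕP.≤-pred k+2<n))))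
    | ℤP.pos-+ 1 k | ℤP.pos-+ 2 k = ring (+ m) (+ k)
    where ring : ∀ M K → + 2 * (+ 2 * M + + 4 + + 2 * (+ 1 + K)) - (+ 2 * M + + 4 + + 2 * (+ 2 + K)) - (+ 2 * M + + 4 + + 2 * K) ≡ + 0
          ring = solve-∀
  pendant : + 2 * w-det1 m (suc (suc m)) - w-det1 m 0 ≡ + 0
  pendant rewrite w-det1-pendant m = ring (+ m)
    where ring : ∀ M → + 2 * (+ 2 * M + + 3) - (+ 4 * M + + 6) ≡ + 0
          ring = solve-∀

InV-a-det1 : ∀ m → InV (suc (suc m)) (+ 2) 1
InV-a-det1 m = InV-one m a-det1 (w-det1 m) a-det1≥2 (Mrow-w-det1 m)
  (trans (ring (+ m)) (cong (+ 2 *_) (sym (continuant-a-det1 m)))) (λ k _ → w-det1>0 m k)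
  where ring : ∀ M → + 4 * M + + 6 ≡ + 2 * (+ 2 * M + + 3)
        ring = solve-∀

-- On C_8^+, z-eight spans the kernel of M(a) for a = 2 except a₅ = 10.
z-eight : ℕ → ℤ
z-eight 0 = + 16
z-eight 1 = + 13
z-eight 2 = + 10
z-eight 3 = + 7
z-eight 4 = + 4
z-eight 5 = + 1
z-eight 6 = + 6
z-eight 7 = + 11
z-eight _ = + 8

Mrow-z-eight : ∀ i → i ℕ.< 9 → Mrow 8 (setAt 5 (+ 10) (λ _ → + 2)) z-eight i ≡ + 0
Mrow-z-eight 0 _ = refl
Mrow-z-eight 1 _ = refl
Mrow-z-eight 2 _ = refl
Mrow-z-eight 3 _ = refl
Mrow-z-eight 4 _ = refl
Mrow-z-eight 5 _ = refl
Mrow-z-eight 6 _ = refl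
Mrow-z-eight 7 _ = refl
Mrow-z-eight 8 _ = refl
Mrow-z-eight (suc (suc (suc (suc (suc (suc (suc (suc (suc i))))))))) (s≤s (s≤s (s≤s (s≤s (s≤s (s≤s (s≤s (s≤s (s≤s ())))))))))

z-eight>0 : ∀ k → k ℕ.< 9 → + 0 ℤ.< z-eight k
z-eight>0 0 _ = ℤ.+<+ (s≤s z≤n)
z-eight>0 1 _ = ℤ.+<+ (s≤s z≤n)
z-eight>0 2 _ = ℤ.+<+ (s≤s z≤n)
z-eight>0 3 _ = ℤ.+<+ (s≤s z≤n)
z-eight>0 4 _ = ℤ.+<+ (s≤s z≤n)
z-eight>0 5 _ = ℤ.+<+ (s≤s z≤n)
z-eight>0 6 _ = ℤ.+<+ (s≤s z≤n)
z-eight>0 7 _ = ℤ.+<+ (s≤s z≤n)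
z-eight>0 (suc (suc (suc (suc (suc (suc (suc (suc k)))))))) _ = ℤ.+<+ (s≤s z≤n)

InV-eight : ∀ u → InV (suc (suc 6)) (+ 2) u
InV-eight = Family.InV-family 6 (λ _ → + 2) z-eight 5 (+ 10) (ℕP.+-monoʳ-≤ 6 z≤n)
  (λ _ → ℤP.≤-refl) (ℤ.+≤+ (s≤s (s≤s z≤n))) Mrow-z-eight refl z-eight>0 refl

three-above : ∀ q d → q ℕ.< d → d ℕ.< 4 ℕ.+ q → d ≡ 1 ℕ.+ q ⊎ d ≡ 2 ℕ.+ q ⊎ d ≡ 3 ℕ.+ q
three-above zero (suc zero) _ _ = inj₁ refl
three-above zero (suc (suc zero)) _ _ = inj₂ (inj₁ refl)
three-above zero (suc (suc (suc zero))) _ _ = inj₂ (inj₂ refl)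
three-above zero (suc (suc (suc (suc d)))) _ (s≤s (s≤s (s≤s (s≤s ()))))
three-above (suc q) (suc d) (s≤s q<d) (s≤s d<q+4) with three-above q d q<d (ℕP.≤-trans d<q+4 (ℕP.≤-reflexive (ℕP.+-suc 3 q)))
... | inj₁ d≡ = inj₁ (cong suc d≡)
... | inj₂ (inj₁ d≡) = inj₂ (inj₁ (cong suc d≡))
... | inj₂ (inj₂ d≡) = inj₂ (inj₂ (cong suc d≡))

-- On C_n^+ with n = q + 9 the kernel vector z descends linearly from vertex 0 to the
-- vertex 6 + q where it equals 1, with a kink at vertex 5 where a₅ = 3.
module LargeCycle (q : ℕ) where

  Q : ℤ
  Q = + q

  base : ℕ → ℤ
  base k = if k ≡ᵇ 5 then + 3 else + 2

  β : ℤ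
  β = + 13 + + 4 * Q

  a-β : ℕ → ℤ
  a-β = setAt (6 ℕ.+ q) β base

  descent₁ : ℕ → ℤ
  descent₁ k = + 28 + + 12 * Q - + k * (+ 5 + + 2 * Q)

  descent₂ : ℕ → ℤ
  descent₂ k = + 13 + + 2 * Q - + 2 * + k

  z : ℕ → ℤ
  z k = if k ℕ.<ᵇ 6 then descent₁ k else if k ℕ.<ᵇ 7 ℕ.+ q then descent₂ k else
        if k ≡ᵇ 7 ℕ.+ q then + 10 + + 4 * Q else if k ≡ᵇ 8 ℕ.+ q then + 19 + + 8 * Q else + 14 + + 6 * Q

  z-descent₂ : ∀ k → 5 ℕ.≤ k → k ℕ.< 7 ℕ.+ q → z k ≡ descent₂ k
  z-descent₂ k 5≤k k<7+q with k ℕP.≟ 5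
  ... | yes refl = ring Q
    where ring : ∀ Q → + 28 + + 12 * Q - + 5 * (+ 5 + + 2 * Q) ≡ + 13 + + 2 * Q - + 2 * + 5
          ring = solve-∀
  ... | no k≢5 rewrite <ᵇ-≥ k 6 (ℕP.≤∧≢⇒< 5≤k (k≢5 ∘ sym)) | <ᵇ-< k (7 ℕ.+ q) k<7+q = refl

  z-7+q : z (7 ℕ.+ q) ≡ + 10 + + 4 * Q
  z-7+q rewrite <ᵇ-≥ (7 ℕ.+ q) 6 (ℕP.+-monoʳ-≤ 6 z≤n) | <ᵇ-≥ (7 ℕ.+ q) (7 ℕ.+ q) ℕP.≤-refl | ≡ᵇ-refl (7 ℕ.+ q) = refl

  z-8+q : z (8 ℕ.+ q) ≡ + 19 + + 8 * Q
  z-8+q rewrite <ᵇ-≥ (8 ℕ.+ q) 6 (ℕP.+-monoʳ-≤ 6 z≤n) | <ᵇ-≥ (8 ℕ.+ q) (7 ℕ.+ q) (ℕP.n≤1+n _)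
    | ≡ᵇ-≢ (8 ℕ.+ q) (7 ℕ.+ q) ℕP.1+n≢n | ≡ᵇ-refl (8 ℕ.+ q) = refl

  z-9+q : z (9 ℕ.+ q) ≡ + 14 + + 6 * Q
  z-9+q rewrite <ᵇ-≥ (9 ℕ.+ q) 6 (ℕP.+-monoʳ-≤ 6 z≤n) | <ᵇ-≥ (9 ℕ.+ q) (7 ℕ.+ q) (ℕP.≤-trans (ℕP.n≤1+n _) (ℕP.n≤1+n _))
    | ≡ᵇ-≢ (9 ℕ.+ q) (7 ℕ.+ q) (ℕP.<⇒≢ (ℕP.≤-trans (ℕP.n<1+n _) (ℕP.n≤1+n _)) ∘ sym)
    | ≡ᵇ-≢ (9 ℕ.+ q) (8 ℕ.+ q) ℕP.1+n≢n = refl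

  a-β-two : ∀ k → k ≢ 6 ℕ.+ q → k ≢ 5 → a-β k ≡ + 2
  a-β-two k k≢jj k≢5 rewrite ≡ᵇ-≢ k (6 ℕ.+ q) k≢jj | ≡ᵇ-≢ k 5 k≢5 = refl

  a-β-jj : a-β (6 ℕ.+ q) ≡ β
  a-β-jj rewrite ≡ᵇ-refl (6 ℕ.+ q) = refl

  row-0 : a-β 0 * z 0 - z 1 - z (suc (7 ℕ.+ q)) - z (suc (suc (7 ℕ.+ q))) ≡ + 0
  row-0 rewrite z-8+q | z-9+q = ring Q
    where ring : ∀ Q → + 2 * (+ 28 + + 12 * Q - + 0 * (+ 5 + + 2 * Q)) - (+ 28 + + 12 * Q - + 1 * (+ 5 + + 2 * Q)) - (+ 19 + + 8 * Q) - (+ 14 + + 6 * Q) ≡ + 0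
          ring = solve-∀

  row-last : a-β (suc (7 ℕ.+ q)) * z (suc (7 ℕ.+ q)) - z 0 - z (7 ℕ.+ q) ≡ + 0
  row-last rewrite a-β-two (8 ℕ.+ q) (λ e → ℕP.<-irrefl (sym e) (ℕP.≤-trans (ℕP.n<1+n _) (ℕP.n≤1+n _))) (λ ())
    | z-8+q | z-7+q = ring Q
    where ring : ∀ Q → + 2 * (+ 19 + + 8 * Q) - (+ 28 + + 12 * Q - + 0 * (+ 5 + + 2 * Q)) - (+ 10 + + 4 * Q) ≡ + 0
          ring = solve-∀

  row-pendant : a-β (suc (suc (7 ℕ.+ q))) * z (suc (suc (7 ℕ.+ q))) - z 0 ≡ + 0
  row-pendant rewrite a-β-two (9 ℕ.+ q) (λ e → ℕP.<-irrefl (sym e) (ℕP.≤-trans (ℕP.n<1+n _) (ℕP.≤-trans (ℕP.n≤1+n _) (ℕP.n≤1+n _)))) (λ ())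
    | z-9+q = ring Q
    where ring : ∀ Q → + 2 * (+ 14 + + 6 * Q) - (+ 28 + + 12 * Q - + 0 * (+ 5 + + 2 * Q)) ≡ + 0
          ring = solve-∀

  descent₁-harmonic : ∀ k → + 2 * descent₁ (suc k) - descent₁ (suc (suc k)) - descent₁ k ≡ + 0
  descent₁-harmonic k rewrite ℤP.pos-+ 1 k | ℤP.pos-+ 2 k = ring Q (+ k)
    where ring : ∀ Q K → + 2 * (+ 28 + + 12 * Q - (+ 1 + K) * (+ 5 + + 2 * Q)) - (+ 28 + + 12 * Q - (+ 2 + K) * (+ 5 + + 2 * Q))
                         - (+ 28 + + 12 * Q - K * (+ 5 + + 2 * Q)) ≡ + 0
          ring = solve-∀

  descent₂-harmonic : ∀ k → + 2 * descent₂ (suc k) - descent₂ (suc (suc k)) - descent₂ k ≡ + 0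
  descent₂-harmonic k rewrite ℤP.pos-+ 1 k | ℤP.pos-+ 2 k = ring Q (+ k)
    where ring : ∀ Q K → + 2 * (+ 13 + + 2 * Q - + 2 * (+ 1 + K)) - (+ 13 + + 2 * Q - + 2 * (+ 2 + K)) - (+ 13 + + 2 * Q - + 2 * K) ≡ + 0
          ring = solve-∀

  row-inner : ∀ k → suc (suc k) ℕ.< suc (suc (7 ℕ.+ q)) → a-β (suc k) * z (suc k) - z (suc (suc k)) - z k ≡ + 0
  row-inner 0 _ = descent₁-harmonic 0
  row-inner 1 _ = descent₁-harmonic 1
  row-inner 2 _ = descent₁-harmonic 2
  row-inner 3 _ = descent₁-harmonic 3
  row-inner 4 _ = ring Q
    where ring : ∀ Q → + 3 * (+ 28 + + 12 * Q - + 5 * (+ 5 + + 2 * Q)) - (+ 13 + + 2 * Q - + 2 * + 6) - (+ 28 + + 12 * Q - + 4 * (+ 5 + + 2 * Q)) ≡ + 0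
          ring = solve-∀
  row-inner (suc (suc (suc (suc (suc k))))) k+7<n = row-inner-tail k k+7<n
    where
    row-inner-tail : ∀ k → 7 ℕ.+ k ℕ.< 9 ℕ.+ q → a-β (6 ℕ.+ k) * z (6 ℕ.+ k) - z (7 ℕ.+ k) - z (5 ℕ.+ k) ≡ + 0
    row-inner-tail k k+7<n with ℕP.<-cmp k q
    ... | tri< k<q _ _ rewrite a-β-two (6 ℕ.+ k) (λ e → ℕP.<-irrefl (ℕP.+-cancelˡ-≡ 6 _ _ e) k<q) (λ ())
           | z-descent₂ (6 ℕ.+ k) (ℕP.≤-trans (ℕP.n≤1+n 5) (ℕP.m≤m+n 6 k)) (s≤s (ℕP.+-monoʳ-≤ 6 (ℕP.<⇒≤ k<q)))
           | z-descent₂ (7 ℕ.+ k) (ℕP.≤-trans (ℕP.≤-trans (ℕP.n≤1+n 5) (ℕP.n≤1+n 6)) (ℕP.m≤m+n 7 k)) (ℕP.+-monoʳ-≤ 7 k<q)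
           | z-descent₂ (5 ℕ.+ k) (ℕP.m≤m+n 5 k) (ℕP.≤-trans (s≤s (ℕP.+-monoʳ-≤ 5 (ℕP.<⇒≤ k<q))) (ℕP.n≤1+n _)) =
      descent₂-harmonic (5 ℕ.+ k)
    ... | tri≈ _ refl _ rewrite a-β-jj | z-descent₂ (6 ℕ.+ q) (ℕP.≤-trans (ℕP.n≤1+n 5) (ℕP.m≤m+n 6 q)) (ℕP.n<1+n _) | z-7+q
           | z-descent₂ (5 ℕ.+ q) (ℕP.m≤m+n 5 q) (ℕP.≤-trans (ℕP.n<1+n _) (ℕP.n≤1+n _)) | ℤP.pos-+ 6 q | ℤP.pos-+ 5 q = ring Q
      where ring : ∀ Q → (+ 13 + + 4 * Q) * (+ 13 + + 2 * Q - + 2 * (+ 6 + Q)) - (+ 10 + + 4 * Q) - (+ 13 + + 2 * Q - + 2 * (+ 5 + Q)) ≡ + 0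
            ring = solve-∀
    ... | tri> _ _ q<k with ℕP.m≤n⇒m<n∨m≡n (ℕP.+-cancelˡ-≤ 7 _ _ (ℕP.≤-pred k+7<n))
    ...   | inj₁ k<q+1 = ⊥-elim (ℕP.<-irrefl refl (ℕP.≤-trans q<k (ℕP.≤-pred k<q+1)))
    ...   | inj₂ refl rewrite a-β-two (7 ℕ.+ q) ℕP.1+n≢n (λ ()) | z-7+q | z-8+q
           | z-descent₂ (6 ℕ.+ q) (ℕP.≤-trans (ℕP.n≤1+n 5) (ℕP.m≤m+n 6 q)) (ℕP.n<1+n _) | ℤP.pos-+ 6 q = ring Q
      where ring : ∀ Q → + 2 * (+ 10 + + 4 * Q) - (+ 19 + + 8 * Q) - (+ 13 + + 2 * Q - + 2 * (+ 6 + Q)) ≡ + 0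
            ring = solve-∀

  Mrow-z : ∀ i → i ℕ.< suc (suc (suc (7 ℕ.+ q))) → Mrow (suc (suc (7 ℕ.+ q))) a-β z i ≡ + 0
  Mrow-z = Mrow-by-cases (7 ℕ.+ q) a-β z (λ _ → + 0) row-0 row-inner row-last row-pendant

  z-jj : z (6 ℕ.+ q) ≡ + 1
  z-jj rewrite z-descent₂ (6 ℕ.+ q) (ℕP.≤-trans (ℕP.n≤1+n 5) (ℕP.m≤m+n 6 q)) (ℕP.n<1+n _) | ℤP.pos-+ 6 q = ring Q
    where ring : ∀ Q → + 13 + + 2 * Q - + 2 * (+ 6 + Q) ≡ + 1
          ring = solve-∀

  z>0 : ∀ k → k ℕ.< 10 ℕ.+ q → + 0 ℤ.< z k
  z>0 0 _ = subst (+ 0 ℤ.<_) (sym (ring Q)) (0<c*x+suc 12 Q 27 (ℤ.+≤+ z≤n))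
    where ring : ∀ Q → + 28 + + 12 * Q - + 0 * (+ 5 + + 2 * Q) ≡ + 12 * Q + + 28
          ring = solve-∀
  z>0 1 _ = subst (+ 0 ℤ.<_) (sym (ring Q)) (0<c*x+suc 10 Q 22 (ℤ.+≤+ z≤n))
    where ring : ∀ Q → + 28 + + 12 * Q - + 1 * (+ 5 + + 2 * Q) ≡ + 10 * Q + + 23
          ring = solve-∀
  z>0 2 _ = subst (+ 0 ℤ.<_) (sym (ring Q)) (0<c*x+suc 8 Q 17 (ℤ.+≤+ z≤n))
    where ring : ∀ Q → + 28 + + 12 * Q - + 2 * (+ 5 + + 2 * Q) ≡ + 8 * Q + + 18
          ring = solve-∀
  z>0 3 _ = subst (+ 0 ℤ.<_) (sym (ring Q)) (0<c*x+suc 6 Q 12 (ℤ.+≤+ z≤n))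
    where ring : ∀ Q → + 28 + + 12 * Q - + 3 * (+ 5 + + 2 * Q) ≡ + 6 * Q + + 13
          ring = solve-∀
  z>0 4 _ = subst (+ 0 ℤ.<_) (sym (ring Q)) (0<c*x+suc 4 Q 7 (ℤ.+≤+ z≤n))
    where ring : ∀ Q → + 28 + + 12 * Q - + 4 * (+ 5 + + 2 * Q) ≡ + 4 * Q + + 8
          ring = solve-∀
  z>0 5 _ = subst (+ 0 ℤ.<_) (sym (ring Q)) (0<c*x+suc 2 Q 2 (ℤ.+≤+ z≤n))
    where ring : ∀ Q → + 28 + + 12 * Q - + 5 * (+ 5 + + 2 * Q) ≡ + 2 * Q + + 3
          ring = solve-∀
  z>0 (suc (suc (suc (suc (suc (suc d)))))) (s≤s (s≤s (s≤s (s≤s (s≤s (s≤s d<q+4)))))) with d ℕP.≤? q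
  ... | yes d≤q = subst (+ 0 ℤ.<_)
          (sym (trans (z-descent₂ (6 ℕ.+ d) (ℕP.≤-trans (ℕP.n≤1+n 5) (ℕP.m≤m+n 6 d)) (s≤s (ℕP.+-monoʳ-≤ 6 d≤q))) middle))
                        (0<c*x+suc 2 (+ (q ∸ d)) 0 (ℤ.+≤+ z≤n))
    where
    middle : descent₂ (6 ℕ.+ d) ≡ + 2 * + (q ∸ d) + + 1
    middle = begin
      + 13 + + 2 * Q - + 2 * + (6 ℕ.+ d)
        ≡⟨ cong₂ (λ u v → + 13 + + 2 * u - + 2 * v)
                 (trans (cong +_ (sym (ℕP.m+[n∸m]≡n d≤q))) (ℤP.pos-+ d (q ∸ d))) (ℤP.pos-+ 6 d) ⟩
      + 13 + + 2 * (+ d + + (q ∸ d)) - + 2 * (+ 6 + + d)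
        ≡⟨ ring (+ d) (+ (q ∸ d)) ⟩
      + 2 * + (q ∸ d) + + 1 ∎
      where ring : ∀ D E → + 13 + + 2 * (D + E) - + 2 * (+ 6 + D) ≡ + 2 * E + + 1
            ring = solve-∀
  ... | no d≰q with three-above q d (ℕP.≰⇒> d≰q) d<q+4
  ...   | inj₁ refl = subst (+ 0 ℤ.<_) (sym z-7+q) (subst (+ 0 ℤ.<_) (ℤP.+-comm (+ 4 * Q) (+ 10)) (0<c*x+suc 4 Q 9 (ℤ.+≤+ z≤n)))
  ...   | inj₂ (inj₁ refl) = subst (+ 0 ℤ.<_) (sym z-8+q) (subst (+ 0 ℤ.<_) (ℤP.+-comm (+ 8 * Q) (+ 19)) (0<c*x+suc 8 Q 18 (ℤ.+≤+ z≤n)))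
  ...   | inj₂ (inj₂ refl) = subst (+ 0 ℤ.<_) (sym z-9+q) (subst (+ 0 ℤ.<_) (ℤP.+-comm (+ 6 * Q) (+ 14)) (0<c*x+suc 6 Q 13 (ℤ.+≤+ z≤n)))

  base≥2 : ∀ k → + 2 ℤ.≤ base k
  base≥2 k with k ≡ᵇ 5
  ... | true = ℤ.+≤+ (s≤s (s≤s z≤n))
  ... | false = ℤP.≤-refl

  β≥2 : + 2 ℤ.≤ β
  β≥2 = ℤP.+-mono-≤ {+ 2} {+ 13} {+ 0} (ℤ.+≤+ (s≤s (s≤s z≤n))) (0≤i*j (+ 4) Q (ℤ.+≤+ z≤n) (ℤ.+≤+ z≤n))

  S : ℤ
  S = + 34 + + 12 * Q

  -- Continuants of a-β read from a vertex s ≥ 6: the entries are 2 except β at 6 + q.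
  continuant-tail : ∀ d s → s ℕ.+ d ≡ 6 ℕ.+ q → 6 ℕ.≤ s →
    continuant a-β (3 ℕ.+ d) s ≡ + 3 + (+ 1 + + d) * S × continuant a-β (2 ℕ.+ d) (suc s) ≡ + 3 + + d * S
  continuant-tail zero s s≡jj _ rewrite ℕP.+-identityʳ s | s≡jj | a-β-jj
    | a-β-two (7 ℕ.+ q) ℕP.1+n≢n (λ ())
    | a-β-two (8 ℕ.+ q) (ℕP.<⇒≢ (ℕP.≤-trans (ℕP.n<1+n _) (ℕP.n≤1+n _)) ∘ sym) (λ ()) = ring Q , refl
    where ring : ∀ Q → (+ 13 + + 4 * Q) * (+ 2 * + 2 - + 1) - + 2 ≡ + 3 + (+ 1 + + 0) * (+ 34 + + 12 * Q)
          ring = solve-∀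
  continuant-tail (suc d) s s+d+1≡jj 6≤s = first , trans (proj₁ next) (cong (λ v → + 3 + v * S) (sym (ℤP.pos-+ 1 d)))
    where
    next = continuant-tail d (suc s) (trans (sym (ℕP.+-suc s d)) s+d+1≡jj) (ℕP.≤-trans 6≤s (ℕP.n≤1+n s))
    s≢jj : s ≢ 6 ℕ.+ q
    s≢jj s≡jj = ℕP.<-irrefl refl (subst (ℕ._≤ 6 ℕ.+ q) (cong suc s≡jj)
      (ℕP.≤-trans (s≤s (ℕP.m≤m+n s d)) (ℕP.≤-reflexive (trans (sym (ℕP.+-suc s d)) s+d+1≡jj))))
    first : continuant a-β (3 ℕ.+ suc d) s ≡ + 3 + (+ 1 + + suc d) * S
    first = begin
      a-β s * continuant a-β (3 ℕ.+ d) (suc s) - continuant a-β (2 ℕ.+ d) (suc (suc s))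
        ≡⟨ cong₂ (λ u v → u * continuant a-β (3 ℕ.+ d) (suc s) - v)
                 (a-β-two s s≢jj (λ s≡5 → ℕP.<-irrefl (sym s≡5) 6≤s)) (proj₂ next) ⟩
      + 2 * continuant a-β (3 ℕ.+ d) (suc s) - (+ 3 + + d * S)
        ≡⟨ cong (λ v → + 2 * v - (+ 3 + + d * S)) (proj₁ next) ⟩
      + 2 * (+ 3 + (+ 1 + + d) * S) - (+ 3 + + d * S)
        ≡⟨ ring (+ d) S ⟩
      + 3 + (+ 1 + (+ 1 + + d)) * S
        ≡⟨ cong (λ v → + 3 + (+ 1 + v) * S) (sym (ℤP.pos-+ 1 d)) ⟩
      + 3 + (+ 1 + + suc d) * S ∎
      where ring : ∀ D S → + 2 * (+ 3 + (+ 1 + D) * S) - (+ 3 + D * S) ≡ + 3 + (+ 1 + (+ 1 + D)) * S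
            ring = solve-∀

  -- The first five steps of the recurrence only see the entries a₁ … a₄ = 2 and a₅ = 3.
  five-steps : ℤ → ℤ → ℤ
  five-steps X Y = + 2 * (+ 2 * (+ 2 * (+ 2 * (+ 3 * X - Y) - X) - (+ 3 * X - Y)) - (+ 2 * (+ 3 * X - Y) - X))
    - (+ 2 * (+ 2 * (+ 3 * X - Y) - X) - (+ 3 * X - Y))

  continuant-from-1 : continuant a-β (suc (7 ℕ.+ q)) 1 ≡ five-steps (continuant a-β (3 ℕ.+ q) 6) (continuant a-β (2 ℕ.+ q) 7)
  continuant-from-1 = refl

  minor≡z0² : a-β (suc (suc (7 ℕ.+ q))) * continuant a-β (suc (7 ℕ.+ q)) 1 ≡ z 0 * z 0
  minor≡z0² = begin
    a-β (9 ℕ.+ q) * continuant a-β (8 ℕ.+ q) 1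
      ≡⟨ cong₂ _*_ (a-β-two (9 ℕ.+ q) (ℕP.<⇒≢ (ℕP.≤-trans (ℕP.n<1+n _) (ℕP.≤-trans (ℕP.n≤1+n _) (ℕP.n≤1+n _))) ∘ sym) (λ ()))
                   continuant-from-1 ⟩
    + 2 * five-steps (continuant a-β (3 ℕ.+ q) 6) (continuant a-β (2 ℕ.+ q) 7)
      ≡⟨ cong₂ (λ X Y → + 2 * five-steps X Y) (proj₁ tail) (proj₂ tail) ⟩
    + 2 * five-steps (+ 3 + (+ 1 + Q) * S) (+ 3 + Q * S)
      ≡⟨ ring Q ⟩
    z 0 * z 0 ∎
    where
    tail = continuant-tail q 6 refl ℕP.≤-refl
    ring : ∀ Q → + 2 * (let X = + 3 + (+ 1 + Q) * (+ 34 + + 12 * Q) ; Y = + 3 + Q * (+ 34 + + 12 * Q) in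
             + 2 * (+ 2 * (+ 2 * (+ 2 * (+ 3 * X - Y) - X) - (+ 3 * X - Y)) - (+ 2 * (+ 3 * X - Y) - X)) - (+ 2 * (+ 2 * (+ 3 * X - Y) - X) - (+ 3 * X - Y)))
             ≡ (+ 28 + + 12 * Q - + 0 * (+ 5 + + 2 * Q)) * (+ 28 + + 12 * Q - + 0 * (+ 5 + + 2 * Q))
    ring = solve-∀

  InV-large : ∀ u → InV (suc (suc (7 ℕ.+ q))) (+ 2) u
  InV-large = Family.InV-family (7 ℕ.+ q) base z (6 ℕ.+ q) β (ℕP.m≤n+m (7 ℕ.+ q) 3)
    base≥2 β≥2 Mrow-z z-jj z>0 minor≡z0²

-- The endpoints of the casts are given explicitly: unifying InV at syntactically different
-- sizes would unfold both determinants into their full Laplace expansions.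
InV-cast : ∀ {n n′ r u} → n ≡ n′ → InV n r u → InV n′ r u
InV-cast refl v = v

InV-any : ∀ {m} → 6 ≤ m → ∀ u → InV (suc (suc m)) (+ 2) u
InV-any (s≤s (s≤s (s≤s (s≤s (s≤s (s≤s {n = zero} z≤n)))))) u =
  InV-cast {suc (suc 6)} {suc (suc (suc (suc (suc (suc (suc (suc zero)))))))} refl (InV-eight u)
InV-any (s≤s (s≤s (s≤s (s≤s (s≤s (s≤s {n = suc q} z≤n)))))) u =
  InV-cast {suc (suc (7 ℕ.+ q))} {suc (suc (suc (suc (suc (suc (suc (suc (suc q))))))))} refl (LargeCycle.InV-large q u)

proposition3p2 : (n : ℕ) → 2 ≤ n →
    InV n (+ 2) 1 × (8 ≤ n → (u : ℕ) → InV n (+ 2) u)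
proposition3p2 (suc (suc m)) _ = InV-a-det1 m , λ 8≤n → InV-any (ℕP.≤-pred (ℕP.≤-pred 8≤n))
proposition3p2 (suc zero) (s≤s ())
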